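{- Let $n\ge1$ and let $H_n$ be the graph whose vertices are the unit squares of $AD(n)$ lying in the half-plane $x\le0$, two squares adjacent iff they share an edge, with distinguished vertices $v_1,\ldots,v_{2n}$ the squares $[-1,0]\times[j,j+1]$ for $j=n-1,n-2,\ldots,-n$ in this order. Then for every $\epsilon=(\epsilon_1,\ldots,\epsilon_{2n})\in\{0,1\}^{2n}$, $C_n(\epsilon)$ equals the number of perfect matchings of the graph obtained from $H_n$ by deleting every $v_i$ with $\epsilon_i=1$.
   Context: $AD(n)$ is the union of all unit lattice squares $[i,i+1]\times[j,j+1]$ ($i,j\in\mathbb{Z}$) contained in $|x|+|y|\le n+1$. For $m\ge1$, $\mathbb{Z}\langle\{0,1\}^m\rangle$ is the free abelian group with basis the binary sequences of length $m$; maps on basis elements are extended $\mathbb{Z}$-linearly, and functions $\{0,1\}^m\to\mathbb{Z}_{\ge0}$ extend to homomorphisms to $\mathbb{Z}$. (i) $R_m(\epsilon_1,\ldots,\epsilon_m)=(1-\epsilon_1,\ldots,1-\epsilon_m)$. (ii) For $m\ge2$, $1\le i\le m-1$: $E_m^i(\epsilon)=\epsilon+\epsilon'$ if $(\epsilon_i,\epsilon_{i+1})=(0,0)$, with $\epsilon'$ equal to $\epsilon$ with entries $i,i+1$ replaced by $1,1$; $E_m^i(\epsilon)=\epsilon$ otherwise. $E_m=E_m^{m-1}\circ\cdots\circ E_m^1$. (iii) For $m\ge4$, $K_m:\mathbb{Z}\langle\{0,1\}^m\rangle\to\mathbb{Z}\langle\{0,1\}^{m-2}\rangle$: $K_m(\epsilon)=0$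 if $(\epsilon_1,\epsilon_2)=(0,1)$ or $(\epsilon_{m-1},\epsilon_m)=(1,0)$; otherwise $K_m(\epsilon)=(a,\epsilon_3,\ldots,\epsilon_{m-2},b)$ with $a=0$ if $(\epsilon_1,\epsilon_2)=(1,0)$, $a=1$ if $(\epsilon_1,\epsilon_2)\in\{(0,0),(1,1)\}$, $b=0$ if $(\epsilon_{m-1},\epsilon_m)=(0,1)$, $b=1$ if $(\epsilon_{m-1},\epsilon_m)\in\{(0,0),(1,1)\}$. (iv) $C_1(0,0)=C_1(1,1)=1$, $C_1(0,1)=C_1(1,0)=0$; for $n\ge2$, $C_n:\{0,1\}^{2n}\to\mathbb{Z}_{\ge0}$ is $C_n=C_{n-1}\circ R_{2n-2}\circ E_{2n-2}\circ K_{2n}$. -}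

module Defs where

open import Data.Bool using (Bool; true; false; not; if_then_else_)
open import Data.Nat as ℕ using (ℕ; zero; suc; _∸_)
open import Data.Integer as ℤ using (ℤ; +_; -_; ∣_∣)
open import Data.List as List using (List; []; _∷_; _++_; map; concatMap; foldl; filter; length; upTo)
open import Data.Nat.ListAction using (sum)
open import Data.List.Relation.Unary.All using (All; all?)
open import Data.List.Membership.DecPropositional using ()
open import Data.Maybe using (Maybe; just; nothing; maybe)
open import Data.Product using (_×_; _,_; proj₁; proj₂)
open import Data.Product.Properties using (≡-dec)
open import Data.Sum using (_⊎_)
open import Data.Vec as Vec using (Vec; []; _∷_; _∷ʳ_)
open import Relation.Nullary using (Dec; yes; no; ¬_)
open import Relation.Nullary.Decidable using (_⊎-dec_; ¬?)
open import Relation.Binary.PropositionalEquality using (_≡_)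

-- Binary sequences: Vec Bool m, with false = 0 and true = 1.
-- Elements of Z⟨{0,1}^m⟩ with nonnegative coefficients are represented
-- as formal sums, i.e. lists of basis elements (with multiplicity).
-- All maps R, E, K below send basis elements to such sums, so this
-- suffices to compute C_n on basis elements.

FSum : ℕ → Set
FSum m = List (Vec Bool m)

double : ℕ → ℕ
double zero    = zero
double (suc n) = suc (suc (double n))

R : ∀ {m} → Vec Bool m → Vec Bool m
R = Vec.map not

-- (ii) E_m^i with 0-based index k = i - 1:
-- if entries k,k+1 (0-based) are (0,0) return the sequence with them set to (1,1)
setPair : ∀ {m} → ℕ → Vec Bool m → Maybe (Vec Bool m)
setPair zero    (false ∷ false ∷ xs) = just (true ∷ true ∷ xs)
setPair zero    _                    = nothing
setPair (suc k) []                   = nothing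
setPair (suc k) (x ∷ xs)             = Data.Maybe.map (x ∷_) (setPair k xs)

Ei : ∀ {m} → ℕ → Vec Bool m → FSum m
Ei k v = v ∷ maybe (λ v' → v' ∷ []) [] (setPair k v)

lin : ∀ {m m'} → (Vec Bool m → FSum m') → FSum m → FSum m'
lin f = concatMap f

-- E_m = E_m^{m-1} ∘ ... ∘ E_m^1  (E^1 applied first), on formal sums
E : ∀ {m} → FSum m → FSum m
E {m} xs = foldl (λ acc k → lin (Ei k) acc) xs (upTo (m ∸ 1))

splitLast2 : ∀ {A : Set} {m} → Vec A (suc (suc m)) → Vec A m × A × A
splitLast2 {m = zero}  (x ∷ y ∷ []) = [] , x , y
splitLast2 {m = suc m} (x ∷ xs) with splitLast2 xs
... | ys , a , b = (x ∷ ys) , a , b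

aCode : Bool → Bool → Maybe Bool
aCode false true  = nothing
aCode true  false = just false
aCode false false = just true
aCode true  true  = just true

bCode : Bool → Bool → Maybe Bool
bCode true  false = nothing
bCode false true  = just false
bCode false false = just true
bCode true  true  = just true

K : ∀ {m} → Vec Bool (suc (suc (suc (suc m)))) → FSum (suc (suc m))
K (e₁ ∷ e₂ ∷ rest) with splitLast2 rest | aCode e₁ e₂
... | mid , e₃ , e₄ | nothing = []
... | mid , e₃ , e₄ | just a with bCode e₃ e₄
...   | nothing = []
...   | just b  = (a ∷ (mid ∷ʳ b)) ∷ []

-- (iv) C_n : {0,1}^{2n} → ℕ  (n ≥ 1; the value at n = 0 is an unused junk value)
C : (n : ℕ) → Vec Bool (double n) → ℕ
C zero          []           = 0
C (suc zero)    (false ∷ false ∷ []) = 1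
C (suc zero)    (true  ∷ true  ∷ []) = 1
C (suc zero)    (false ∷ true  ∷ []) = 0
C (suc zero)    (true  ∷ false ∷ []) = 0
C (suc (suc k)) v            =
  sum (map (C (suc k)) (map R (E (K v))))

-- The graph H_n.  A unit square [i,i+1]×[j,j+1] is encoded by its
-- lower-left corner (i , j) ∈ ℤ × ℤ.

Sq : Set
Sq = ℤ × ℤ

_≟Sq_ : (u v : Sq) → Dec (u ≡ v)
_≟Sq_ = ≡-dec ℤ._≟_ ℤ._≟_

inDiamond : ℕ → ℤ → ℤ → Set
inDiamond n x y = ∣ x ∣ ℕ.+ ∣ y ∣ ℕ.≤ suc n

-- the square with lower-left corner (i , j) is contained in |x|+|y| ≤ n+1
-- (the region is convex, so this holds iff all four corners lie in it)
-- and lies in the half-plane x ≤ 0 (i.e. i + 1 ≤ 0)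
InH : ℕ → Sq → Set
InH n (i , j) =
  inDiamond n i j × inDiamond n (i ℤ.+ ℤ.1ℤ) j ×
  inDiamond n i (j ℤ.+ ℤ.1ℤ) × inDiamond n (i ℤ.+ ℤ.1ℤ) (j ℤ.+ ℤ.1ℤ) ×
  (i ℤ.+ ℤ.1ℤ) ℤ.≤ ℤ.0ℤ

inH? : (n : ℕ) (s : Sq) → Dec (InH n s)
inH? n (i , j) =
  (_ ℕ.≤? _) Relation.Nullary.Decidable.×-dec ((_ ℕ.≤? _) Relation.Nullary.Decidable.×-dec
  ((_ ℕ.≤? _) Relation.Nullary.Decidable.×-dec ((_ ℕ.≤? _) Relation.Nullary.Decidable.×-dec
  ((i ℤ.+ ℤ.1ℤ) ℤ.≤? ℤ.0ℤ))))

rangeℤ : ℤ → ℕ → List ℤ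
rangeℤ a zero    = []
rangeℤ a (suc c) = a ∷ rangeℤ (a ℤ.+ ℤ.1ℤ) c

-- candidate squares: i ∈ [-(n+1), n+1], j ∈ [-(n+1), n+1]
-- (every square contained in |x|+|y| ≤ n+1 has corner coordinates in this range)
candidates : ℕ → List Sq
candidates n =
  concatMap (λ i → map (i ,_) (rangeℤ (- (+ suc n)) (suc (suc (ℕ._*_ 2 (suc n))))))
            (rangeℤ (- (+ suc n)) (suc (suc (ℕ._*_ 2 (suc n)))))

verticesH : ℕ → List Sq
verticesH n = filter (inH? n) (candidates n)

deletedFrom : ∀ {m} → ℤ → Vec Bool m → List Sq
deletedFrom j []       = []
deletedFrom j (e ∷ es) = (if e then ((ℤ.-1ℤ , j) ∷ []) else []) ++ deletedFrom (j ℤ.- ℤ.1ℤ) es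

deleted : (n : ℕ) → Vec Bool (double n) → List Sq
deleted n ε = deletedFrom (+ n ℤ.- ℤ.1ℤ) ε

open import Data.List.Membership.Propositional using (_∈_)
open import Data.List.Membership.Propositional.Properties using ()
open import Data.List.Relation.Unary.Any using (any?)

_∈?_ : (v : Sq) (xs : List Sq) → Dec (v ∈ xs)
v ∈? xs = any? (v ≟Sq_) xs

vertices : (n : ℕ) → Vec Bool (double n) → List Sq
vertices n ε = filter (λ v → ¬? (v ∈? deleted n ε)) (verticesH n)

Adjacent : Sq → Sq → Set
Adjacent (i , j) (i' , j') = ∣ i ℤ.- i' ∣ ℕ.+ ∣ j ℤ.- j' ∣ ≡ 1

adjacent? : (u v : Sq) → Dec (Adjacent u v)
adjacent? (i , j) (i' , j') = _ ℕ.≟ 1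

Edge : Set
Edge = Sq × Sq

pairs : ∀ {A : Set} → List A → List (A × A)
pairs []       = []
pairs (x ∷ xs) = map (x ,_) xs ++ pairs xs

edgesOf : List Sq → List Edge
edgesOf V = filter (λ e → adjacent? (proj₁ e) (proj₂ e)) (pairs V)

sublists : ∀ {A : Set} → List A → List (List A)
sublists []       = [] ∷ []
sublists (x ∷ xs) = map (x ∷_) (sublists xs) ++ sublists xs

Incident : Sq → Edge → Set
Incident v (a , b) = v ≡ a ⊎ v ≡ b

incident? : (v : Sq) (e : Edge) → Dec (Incident v e)
incident? v (a , b) = (v ≟Sq a) ⊎-dec (v ≟Sq b)

IsPerfectMatching : List Sq → List Edge → Set
IsPerfectMatching V M = All (λ v → length (filter (incident? v) M) ≡ 1) V

isPerfectMatching? : (V : List Sq) (M : List Edge) → Dec (IsPerfectMatching V M)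
isPerfectMatching? V M = all? (λ v → length (filter (incident? v) M) ℕ.≟ 1) V

numPerfectMatchings : List Sq → ℕ
numPerfectMatchings V = length (filter (isPerfectMatching? V) (sublists (edgesOf V)))

module Submission where

-- Perfect matchings are counted through the incidence vectors of the edges: numPerfectMatchings V is the
-- number of sublists of these vectors that sum to 1 at every vertex of V.  This count does not depend on
-- the order of V, and it expands along a vertex v as a sum over the neighbours w of v.
--
-- H_n consists of the columns a = 1, …, n of squares [-a, 1-a] × [j, j+1]; column a has 2(n+1-a) squares
-- and starts one row below column a - 1.  The top and the bottom square of the first column have no
-- neighbour in the second column, so each must be matched to its neighbour inside the first column: this
-- is K.  Every other square of the first column is matched either vertically inside the column (the pairs
-- that E adds) or horizontally into the second column; in the latter case the partner square disappears,
-- so the second column keeps exactly the squares marked 0 by R ρ.  What is left is H_(n-1) with deletion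
-- pattern R ρ, which gives the recursion defining C_n; the deleted squares v_i are the squares of the first
-- column marked 1 by ε.

open import Defs
open import Algebra.Bundles using (AbelianGroup)
open import Data.Bool using (Bool; true; false)
open import Data.Empty using (⊥; ⊥-elim)
open import Data.Integer as ℤ using (ℤ; +_; -[1+_]; _⊖_)
import Data.Integer.Properties as ℤ
open import Data.Integer.Tactic.RingSolver using (solve-∀)
open import Data.List using (List; []; _∷_; _++_; map; filter; length; foldl; upTo; concatMap; cartesianProduct; applyUpTo)
open import Data.List.Properties
  using (filter-++; length-++; length-map; filter-≐; filter-accept; filter-reject; filter-all; filter-none;
         map-++; ++-assoc; ++-identityʳ; map-∘; map-cong; map-cong-local; concatMap-++; map-upTo)
open import Data.List.Membership.Propositional using (_∈_; _∉_)
open import Data.List.Membership.Propositional.Properties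
  using (∈-filter⁺; ∈-filter⁻; ∈-++⁻; ∈-++⁺ˡ; ∈-++⁺ʳ; ∈-applyUpTo⁺; ∈-cartesianProduct⁺)
open import Data.List.Membership.Propositional.Properties.WithK using (unique∧set⇒bag)
open import Data.List.Relation.Binary.BagAndSetEquality using (∼bag⇒↭)
open import Data.List.Relation.Binary.Permutation.Propositional as ↭ using (_↭_; ↭⇒↭ₛ′; module PermutationReasoning)
open import Data.List.Relation.Binary.Permutation.Propositional.Properties using (All-resp-↭; filter-↭; shift; shifts; ++⁺ˡ)
import Data.List.Relation.Binary.Permutation.Propositional.Properties as ↭ₚ
import Data.List.Relation.Binary.Permutation.Setoid as Setoid↭
import Data.List.Relation.Binary.Permutation.Setoid.Properties as Setoid↭ₚ
open import Data.List.Relation.Binary.Pointwise as Pointwise using (Pointwise; []; _∷_)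
open import Data.List.Relation.Unary.All as All using (All; []; _∷_; all?)
import Data.List.Relation.Unary.All.Properties as All
open import Data.List.Relation.Unary.AllPairs using ([]; _∷_)
open import Data.List.Relation.Unary.Any using (here; there)
open import Data.List.Relation.Unary.Unique.Propositional using (Unique)
import Data.List.Relation.Unary.Unique.Propositional.Properties as Unique
open import Data.Maybe using (Maybe; just; nothing; maybe; maybe′)
import Data.Maybe as Maybe
open import Data.Nat as ℕ using (ℕ; zero; suc; _+_; _∸_; _≤_; _<_; _≟_; z≤n; s≤s; ∣_-_∣)
open import Data.Nat.Properties as ℕ
  using (+-assoc; +-comm; +-suc; +-identityʳ; +-mono-≤; +-cancelˡ-≤; +-commutativeSemigroup; m≤n+m; m≤m+n; ≤-trans; ≤-reflexive;
         n≢0⇒n>0; ∣-∣-comm; ∣n-n∣≡0; ∣m-n∣≡0⇒m≡n; m+n≡0⇒m≡0; m+n≡0⇒n≡0; m≤n+∣n-m∣; module ≤-Reasoning)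
open import Data.Nat.ListAction using (sum)
open import Data.Nat.ListAction.Properties using (sum-++)
open import Data.Product using (∃₂; _×_; _,_; proj₁; proj₂)
open import Data.Sum using (inj₁; inj₂; [_,_]; swap)
open import Data.Vec using (Vec; []; _∷_; _∷ʳ_; replicate)
open import Function using (_∘_)
open import Function.Bundles using (mk⇔)
open import Relation.Binary.Bundles using (Setoid)
open import Relation.Binary.PropositionalEquality
  using (_≡_; _≢_; refl; sym; trans; cong; cong₂; subst; subst₂; _≗_; _→-setoid_; module ≡-Reasoning)
open import Relation.Nullary using (Dec; yes; no; ¬_; does)
open import Relation.Nullary.Decidable using (¬?; decidable-stable)
open import Relation.Unary using (Decidable)

open import Algebra.Properties.CommutativeSemigroup +-commutativeSemigroup using (interchange; x∙yz≈y∙xz; x∙yz≈yx∙z)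
open import Algebra.Properties.Group (AbelianGroup.group ℤ.+-0-abelianGroup) using () renaming (∙-cancelˡ to +-cancelˡ)

indicator : ∀ {P : Set} → Dec P → ℕ
indicator (yes _) = 1
indicator (no _)  = 0

indicator-cong : ∀ {P Q : Set} (p : Dec P) (q : Dec Q) → (P → Q) → (Q → P) → indicator p ≡ indicator q
indicator-cong (yes _) (yes _) _ _ = refl
indicator-cong (yes p) (no ¬q) f _ = ⊥-elim (¬q (f p))
indicator-cong (no ¬p) (yes q) _ g = ⊥-elim (¬p (g q))
indicator-cong (no _)  (no _)  _ _ = refl

indicator-yes : ∀ {P : Set} (p? : Dec P) → P → indicator p? ≡ 1
indicator-yes p? p = indicator-cong p? (yes p) (λ x → x) (λ x → x)

indicator-no : ∀ {P : Set} (p? : Dec P) → ¬ P → indicator p? ≡ 0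
indicator-no p? ¬p = indicator-cong p? (no ¬p) (λ x → x) (λ x → x)

indicator≡0⇒¬ : ∀ {P : Set} (p? : Dec P) → indicator p? ≡ 0 → ¬ P
indicator≡0⇒¬ (no ¬p) _ = ¬p

length-filter-∷ : ∀ {A : Set} {P : A → Set} (P? : Decidable P) x xs →
  length (filter P? (x ∷ xs)) ≡ indicator (P? x) + length (filter P? xs)
length-filter-∷ P? x xs with P? x
... | yes _ = refl
... | no _  = refl

filter-map : ∀ {A B : Set} {P : A → Set} (P? : Decidable P) (f : B → A) xs →
  filter P? (map f xs) ≡ map f (filter (P? ∘ f) xs)
filter-map P? f []       = refl
filter-map P? f (x ∷ xs) with does (P? (f x))
... | true  = cong (f x ∷_) (filter-map P? f xs)
... | false = filter-map P? f xs

filter-comm : ∀ {A : Set} {P Q : A → Set} (P? : Decidable P) (Q? : Decidable Q) xs →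
  filter P? (filter Q? xs) ≡ filter Q? (filter P? xs)
filter-comm P? Q? []       = refl
filter-comm {P = P} {Q} P? Q? (x ∷ xs) = step (P? x) (Q? x)
  where
  open ≡-Reasoning
  IH = filter-comm P? Q? xs
  step : Dec (P x) → Dec (Q x) → filter P? (filter Q? (x ∷ xs)) ≡ filter Q? (filter P? (x ∷ xs))
  step (yes p) (yes q) = begin
    filter P? (filter Q? (x ∷ xs)) ≡⟨ cong (filter P?) (filter-accept Q? q) ⟩
    filter P? (x ∷ filter Q? xs)   ≡⟨ filter-accept P? p ⟩
    x ∷ filter P? (filter Q? xs)   ≡⟨ cong (x ∷_) IH ⟩
    x ∷ filter Q? (filter P? xs)   ≡⟨ filter-accept Q? q ⟨
    filter Q? (x ∷ filter P? xs)   ≡⟨ cong (filter Q?) (filter-accept P? p) ⟨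
    filter Q? (filter P? (x ∷ xs)) ∎
  step (yes p) (no ¬q) = begin
    filter P? (filter Q? (x ∷ xs)) ≡⟨ cong (filter P?) (filter-reject Q? ¬q) ⟩
    filter P? (filter Q? xs)       ≡⟨ IH ⟩
    filter Q? (filter P? xs)       ≡⟨ filter-reject Q? ¬q ⟨
    filter Q? (x ∷ filter P? xs)   ≡⟨ cong (filter Q?) (filter-accept P? p) ⟨
    filter Q? (filter P? (x ∷ xs)) ∎
  step (no ¬p) (yes q) = begin
    filter P? (filter Q? (x ∷ xs)) ≡⟨ cong (filter P?) (filter-accept Q? q) ⟩
    filter P? (x ∷ filter Q? xs)   ≡⟨ filter-reject P? ¬p ⟩
    filter P? (filter Q? xs)       ≡⟨ IH ⟩
    filter Q? (filter P? xs)       ≡⟨ cong (filter Q?) (filter-reject P? ¬p) ⟨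
    filter Q? (filter P? (x ∷ xs)) ∎
  step (no ¬p) (no ¬q) = begin
    filter P? (filter Q? (x ∷ xs)) ≡⟨ cong (filter P?) (filter-reject Q? ¬q) ⟩
    filter P? (filter Q? xs)       ≡⟨ IH ⟩
    filter Q? (filter P? xs)       ≡⟨ cong (filter Q?) (filter-reject P? ¬p) ⟨
    filter Q? (filter P? (x ∷ xs)) ∎

pairs-⊆ : ∀ {A : Set} (V : List A) → All (λ e → proj₁ e ∈ V × proj₂ e ∈ V) (pairs V)
pairs-⊆ []       = []
pairs-⊆ (x ∷ xs) = All.++⁺ (All.map⁺ {f = x ,_} (All.tabulate λ y∈xs → here refl , there y∈xs))
                           (All.map (λ (a∈ , b∈) → there a∈ , there b∈) (pairs-⊆ xs))

sum-map-++ : ∀ {A : Set} (f : A → ℕ) xs ys → sum (map f (xs ++ ys)) ≡ sum (map f xs) + sum (map f ys)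
sum-map-++ f xs ys = trans (cong sum (map-++ f xs ys)) (sum-++ (map f xs) (map f ys))

sum-map-map : ∀ {A B : Set} (f : B → ℕ) (g : A → B) xs → sum (map f (map g xs)) ≡ sum (map (f ∘ g) xs)
sum-map-map f g xs = cong sum (sym (map-∘ xs))

sum-map-0 : ∀ {A : Set} (xs : List A) → sum (map (λ _ → 0) xs) ≡ 0
sum-map-0 []       = refl
sum-map-0 (x ∷ xs) = sum-map-0 xs

applyUpTo-cong : ∀ {A : Set} {f g : ℕ → A} → (∀ k → f k ≡ g k) → ∀ c → applyUpTo f c ≡ applyUpTo g c
applyUpTo-cong f≗g zero    = refl
applyUpTo-cong f≗g (suc c) = cong₂ _∷_ (f≗g 0) (applyUpTo-cong (f≗g ∘ suc) c)

concatMap≡cartesianProduct : ∀ {A B : Set} (xs : List A) (ys : List B) → concatMap (λ x → map (x ,_) ys) xs ≡ cartesianProduct xs ys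
concatMap≡cartesianProduct []       ys = refl
concatMap≡cartesianProduct (x ∷ xs) ys = cong (map (x ,_) ys ++_) (concatMap≡cartesianProduct xs ys)

-- Counting perfect matchings by incidence vectors

Weight : Set
Weight = Sq → ℕ

0ʷ : Weight
0ʷ _ = 0

_⊕_ : Weight → Weight → Weight
(d ⊕ c) u = d u + c u

incidence : Edge → Weight
incidence e u = indicator (incident? u e)

degree : List Edge → Sq → ℕ
degree M u = length (filter (incident? u) M)

degree-∷ : ∀ e M u → degree (e ∷ M) u ≡ incidence e u + degree M u
degree-∷ e M u = length-filter-∷ (incident? u) e M

IsUnit : List Sq → Weight → Set
IsUnit V c = All (λ u → c u ≡ 1) V

isUnit? : ∀ V c → Dec (IsUnit V c)
isUnit? V c = all? (λ u → c u ≟ 1) V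

-- The number of sublists of ds whose sum, added to c, is 1 at every vertex of V.
exactCovers : List Sq → Weight → List Weight → ℕ
exactCovers V c []       = indicator (isUnit? V c)
exactCovers V c (d ∷ ds) = exactCovers V (d ⊕ c) ds + exactCovers V c ds

isCover? : (V : List Sq) (c : Weight) (M : List Edge) → Dec (IsUnit V (λ u → c u + degree M u))
isCover? V c M = isUnit? V (λ u → c u + degree M u)

coverCount≡exactCovers : ∀ V c L → length (filter (isCover? V c) (sublists L)) ≡ exactCovers V c (map incidence L)
coverCount≡exactCovers V c [] = begin
  length (filter (isCover? V c) ([] ∷ [])) ≡⟨ length-filter-∷ (isCover? V c) [] [] ⟩
  indicator (isCover? V c []) + 0         ≡⟨ +-identityʳ _ ⟩
  indicator (isCover? V c [])             ≡⟨ indicator-cong (isCover? V c []) (isUnit? V c) (All.map (trans (sym (+-identityʳ _))))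
                                                                                            (All.map (trans (+-identityʳ _))) ⟩
  indicator (isUnit? V c)                 ∎
  where open ≡-Reasoning
coverCount≡exactCovers V c (a ∷ L) = begin
  length (filter P? (map add S ++ S))
    ≡⟨ cong length (filter-++ P? (map add S) S) ⟩
  length (filter P? (map add S) ++ filter P? S)
    ≡⟨ length-++ (filter P? (map add S)) ⟩
  length (filter P? (map add S)) + length (filter P? S)
    ≡⟨ cong (_+ length (filter P? S)) withEdge ⟩
  length (filter (isCover? V (incidence a ⊕ c)) S) + length (filter P? S)
    ≡⟨ cong₂ _+_ (coverCount≡exactCovers V (incidence a ⊕ c) L) (coverCount≡exactCovers V c L) ⟩
  exactCovers V c (map incidence (a ∷ L)) ∎
  where
  open ≡-Reasoning
  P? = isCover? V c
  add : List Edge → List Edge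
  add = a ∷_
  S = sublists L
  regroupDegree : ∀ M u → c u + degree (a ∷ M) u ≡ (incidence a ⊕ c) u + degree M u
  regroupDegree M u = trans (cong (λ k → c u + k) (degree-∷ a M u)) (x∙yz≈yx∙z (c u) (incidence a u) (degree M u))
  moveEdge : ∀ {M} → IsUnit V (λ u → c u + degree (a ∷ M) u) → IsUnit V (λ u → (incidence a ⊕ c) u + degree M u)
  moveEdge = All.map (trans (sym (regroupDegree _ _)))
  moveEdge′ : ∀ {M} → IsUnit V (λ u → (incidence a ⊕ c) u + degree M u) → IsUnit V (λ u → c u + degree (a ∷ M) u)
  moveEdge′ = All.map (trans (regroupDegree _ _))
  withEdge : length (filter P? (map add S)) ≡ length (filter (isCover? V (incidence a ⊕ c)) S)
  withEdge = begin
    length (filter P? (map add S))                ≡⟨ cong length (filter-map P? add S) ⟩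
    length (map add (filter (P? ∘ add) S))        ≡⟨ length-map add (filter (P? ∘ add) S) ⟩
    length (filter (P? ∘ add) S)
      ≡⟨ cong length (filter-≐ (P? ∘ add) (isCover? V (incidence a ⊕ c)) (moveEdge , moveEdge′) S) ⟩
    length (filter (isCover? V (incidence a ⊕ c)) S) ∎

incidenceVectors : List Sq → List Weight
incidenceVectors V = map incidence (edgesOf V)

numPerfectMatchings≡exactCovers : ∀ V → numPerfectMatchings V ≡ exactCovers V 0ʷ (incidenceVectors V)
numPerfectMatchings≡exactCovers V = coverCount≡exactCovers V 0ʷ (edgesOf V)

exactCovers-cong : ∀ V {c c'} ds → All (λ u → c u ≡ c' u) V → exactCovers V c ds ≡ exactCovers V c' ds
exactCovers-cong V []       c≡c' = indicator-cong (isUnit? V _) (isUnit? V _)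
  (λ p → All.zipWith (λ (e , q) → trans (sym e) q) (c≡c' , p))
  (λ p → All.zipWith (λ (e , q) → trans e q) (c≡c' , p))
exactCovers-cong V (d ∷ ds) c≡c' =
  cong₂ _+_ (exactCovers-cong V ds (All.map (λ {u} → cong (λ k → d u + k)) c≡c')) (exactCovers-cong V ds c≡c')

exactCovers-↭ : ∀ {V V'} c ds → V ↭ V' → exactCovers V c ds ≡ exactCovers V' c ds
exactCovers-↭ c []       p = indicator-cong (isUnit? _ c) (isUnit? _ c) (All-resp-↭ p) (All-resp-↭ (↭.↭-sym p))
exactCovers-↭ c (d ∷ ds) p = cong₂ _+_ (exactCovers-↭ (d ⊕ c) ds p) (exactCovers-↭ c ds p)

-- Permutation up to pointwise equality: reversing an edge changes its incidence vector only up to _≗_.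
module ↭ʷ where
  open Setoid↭ (Sq →-setoid ℕ) public
  open Setoid↭ₚ (Sq →-setoid ℕ) public
open ↭ʷ using () renaming (_↭_ to _↭ʷ_)

exactCovers-≗ : ∀ V {c c'} {ds ds'} → c ≗ c' → Pointwise _≗_ ds ds' → exactCovers V c ds ≡ exactCovers V c' ds'
exactCovers-≗ V c≗c' []         = exactCovers-cong V [] (All.tabulate (λ {u} _ → c≗c' u))
exactCovers-≗ V c≗c' (d≗d' ∷ p) =
  cong₂ _+_ (exactCovers-≗ V (λ u → cong₂ _+_ (d≗d' u) (c≗c' u)) p) (exactCovers-≗ V c≗c' p)

exactCovers-↭ʷ : ∀ V c {ds ds'} → ds ↭ʷ ds' → exactCovers V c ds ≡ exactCovers V c ds'
private
  exactCovers-↭ʷ-≗ : ∀ {V c c' ds ds'} → ds ↭ʷ ds' → c ≗ c' → exactCovers V c ds ≡ exactCovers V c' ds'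
  exactCovers-↭ʷ-≗ {V} {c' = c'} {ds} p c≗c' = trans (exactCovers-≗ V {ds = ds} c≗c' (Pointwise.refl (λ _ → refl))) (exactCovers-↭ʷ V c' p)
exactCovers-↭ʷ V c (↭ʷ.refl p)  = exactCovers-≗ V (λ _ → refl) p
exactCovers-↭ʷ V c (↭ʷ.prep d≗d' p) = cong₂ _+_ (exactCovers-↭ʷ-≗ p (λ u → cong (_+ c u) (d≗d' u))) (exactCovers-↭ʷ V c p)
exactCovers-↭ʷ V c (↭ʷ.swap {ds} {ds′} {x} {y} {x'} {y'} x≗x' y≗y' p) = begin
  (N (y ⊕ (x ⊕ c)) + N (x ⊕ c)) + (N (y ⊕ c) + N c)   ≡⟨ interchange (N (y ⊕ (x ⊕ c))) _ _ _ ⟩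
  (N (y ⊕ (x ⊕ c)) + N (y ⊕ c)) + (N (x ⊕ c) + N c)
    ≡⟨ cong₂ _+_ (cong₂ _+_ (exactCovers-↭ʷ-≗ p λ u → trans (x∙yz≈y∙xz (y u) (x u) (c u))
                                                   (cong₂ (λ a b → a + (b + c u)) (x≗x' u) (y≗y' u)))
                            (exactCovers-↭ʷ-≗ p λ u → cong (_+ c u) (y≗y' u)))
                 (cong₂ _+_ (exactCovers-↭ʷ-≗ p λ u → cong (_+ c u) (x≗x' u)) (exactCovers-↭ʷ V c p)) ⟩
  (N′ (x' ⊕ (y' ⊕ c)) + N′ (y' ⊕ c)) + (N′ (x' ⊕ c) + N′ c) ∎
  where
  open ≡-Reasoning
  N N′ : Weight → ℕ
  N c = exactCovers V c ds
  N′ c = exactCovers V c ds′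
exactCovers-↭ʷ V c (↭ʷ.trans p q) = trans (exactCovers-↭ʷ V c p) (exactCovers-↭ʷ V c q)

adjacent-sym : ∀ u v → Adjacent u v → Adjacent v u
adjacent-sym (i , j) (i' , j') = trans (cong₂ _+_ (ℤ.∣i-j∣≡∣j-i∣ i' i) (ℤ.∣i-j∣≡∣j-i∣ j' j))

adjacent-irrefl : ∀ u → ¬ Adjacent u u
adjacent-irrefl (i , j) adj with trans (sym (cong₂ _+_ (cong ℤ.∣_∣ (ℤ.+-inverseʳ i)) (cong ℤ.∣_∣ (ℤ.+-inverseʳ j)))) adj
... | ()

adjacentEdge? : (e : Edge) → Dec (Adjacent (proj₁ e) (proj₂ e))
adjacentEdge? (u , v) = adjacent? u v

incidence-swap : ∀ u v → incidence (u , v) ≗ incidence (v , u)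
incidence-swap u v w = indicator-cong (incident? w (u , v)) (incident? w (v , u)) swap swap

starVectors : Sq → List Sq → List Weight
starVectors x ys = map incidence (filter adjacentEdge? (map (x ,_) ys))

starVectors-++ : ∀ x ys zs → starVectors x (ys ++ zs) ≡ starVectors x ys ++ starVectors x zs
starVectors-++ x ys zs = begin
  map incidence (filter adjacentEdge? (map (x ,_) (ys ++ zs)))
    ≡⟨ cong (map incidence ∘ filter adjacentEdge?) (map-++ (x ,_) ys zs) ⟩
  map incidence (filter adjacentEdge? (map (x ,_) ys ++ map (x ,_) zs))
    ≡⟨ cong (map incidence) (filter-++ adjacentEdge? (map (x ,_) ys) _) ⟩
  map incidence (filter adjacentEdge? (map (x ,_) ys) ++ filter adjacentEdge? (map (x ,_) zs))
    ≡⟨ map-++ incidence (filter adjacentEdge? (map (x ,_) ys)) _ ⟩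
  starVectors x ys ++ starVectors x zs ∎
  where open ≡-Reasoning

starVectors-↭ : ∀ x {ys zs} → ys ↭ zs → starVectors x ys ↭ starVectors x zs
starVectors-↭ x p = ↭ₚ.map⁺ incidence (filter-↭ adjacentEdge? (↭ₚ.map⁺ (x ,_) p))

starVectors-swap : ∀ x y → starVectors x (y ∷ []) ↭ʷ starVectors y (x ∷ [])
starVectors-swap x y with adjacent? x y
... | yes xy = ↭ʷ.↭-trans (↭ʷ.↭-reflexive (cong (map incidence) (filter-accept adjacentEdge? {x , y} {[]} xy)))
                (↭ʷ.↭-trans (↭ʷ.prep (incidence-swap x y) ↭ʷ.↭-refl)
                  (↭ʷ.↭-reflexive (sym (cong (map incidence) (filter-accept adjacentEdge? {y , x} {[]} (adjacent-sym x y xy))))))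
... | no ¬xy = ↭ʷ.↭-reflexive (trans (cong (map incidence) (filter-reject adjacentEdge? {x , y} {[]} ¬xy))
                (sym (cong (map incidence) (filter-reject adjacentEdge? {y , x} {[]} (¬xy ∘ adjacent-sym y x)))))

incidenceVectors-∷ : ∀ x xs → incidenceVectors (x ∷ xs) ≡ starVectors x xs ++ incidenceVectors xs
incidenceVectors-∷ x xs =
  trans (cong (map incidence) (filter-++ adjacentEdge? (map (x ,_) xs) (pairs xs)))
        (map-++ incidence (filter adjacentEdge? (map (x ,_) xs)) _)

private
  ↭⇒↭ʷ : ∀ {ds ds'} → ds ↭ ds' → ds ↭ʷ ds'
  ↭⇒↭ʷ = ↭⇒↭ₛ′ (Setoid.isEquivalence (Sq →-setoid ℕ))

incidenceVectors-↭ : ∀ {V V'} → V ↭ V' → incidenceVectors V ↭ʷ incidenceVectors V'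
incidenceVectors-↭ ↭.refl = ↭ʷ.↭-refl
incidenceVectors-↭ (↭.prep {xs} {ys} x p) = begin
  incidenceVectors (x ∷ xs)                ≡⟨ incidenceVectors-∷ x xs ⟩
  starVectors x xs ++ incidenceVectors xs  ↭⟨ ↭ʷ.++⁺ (↭⇒↭ʷ (starVectors-↭ x p)) (incidenceVectors-↭ p) ⟩
  starVectors x ys ++ incidenceVectors ys  ≡⟨ incidenceVectors-∷ x ys ⟨
  incidenceVectors (x ∷ ys)                ∎
  where open ↭ʷ.PermutationReasoning
incidenceVectors-↭ (↭.swap {xs} {ys} x y p) = begin
  incidenceVectors (x ∷ y ∷ xs)
    ≡⟨ trans (incidenceVectors-∷ x (y ∷ xs)) (cong₂ _++_ (starVectors-++ x (y ∷ []) xs) (incidenceVectors-∷ y xs)) ⟩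
  (starVectors x (y ∷ []) ++ starVectors x xs) ++ starVectors y xs ++ incidenceVectors xs
    ≡⟨ ++-assoc (starVectors x (y ∷ [])) _ _ ⟩
  starVectors x (y ∷ []) ++ starVectors x xs ++ starVectors y xs ++ incidenceVectors xs
    ↭⟨ ↭ʷ.++⁺ (starVectors-swap x y) (↭ʷ.shifts (starVectors x xs) (starVectors y xs)) ⟩
  starVectors y (x ∷ []) ++ starVectors y xs ++ starVectors x xs ++ incidenceVectors xs
    ↭⟨ ↭ʷ.++⁺ˡ (starVectors y (x ∷ []))
         (↭ʷ.++⁺ (↭⇒↭ʷ (starVectors-↭ y p)) (↭ʷ.++⁺ (↭⇒↭ʷ (starVectors-↭ x p)) (incidenceVectors-↭ p))) ⟩
  starVectors y (x ∷ []) ++ starVectors y ys ++ starVectors x ys ++ incidenceVectors ys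
    ≡⟨ ++-assoc (starVectors y (x ∷ [])) _ _ ⟨
  (starVectors y (x ∷ []) ++ starVectors y ys) ++ starVectors x ys ++ incidenceVectors ys
    ≡⟨ trans (incidenceVectors-∷ y (x ∷ ys)) (cong₂ _++_ (starVectors-++ y (x ∷ []) ys) (incidenceVectors-∷ x ys)) ⟨
  incidenceVectors (y ∷ x ∷ ys) ∎
  where open ↭ʷ.PermutationReasoning
incidenceVectors-↭ (↭.trans p q) = ↭ʷ.↭-trans (incidenceVectors-↭ p) (incidenceVectors-↭ q)

numPerfectMatchings-↭ : ∀ {V V'} → V ↭ V' → numPerfectMatchings V ≡ numPerfectMatchings V'
numPerfectMatchings-↭ {V} {V'} p = begin
  numPerfectMatchings V                          ≡⟨ numPerfectMatchings≡exactCovers V ⟩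
  exactCovers V  0ʷ (incidenceVectors V)  ≡⟨ exactCovers-↭ʷ V _ (incidenceVectors-↭ p) ⟩
  exactCovers V  0ʷ (incidenceVectors V') ≡⟨ exactCovers-↭ _ (incidenceVectors V') p ⟩
  exactCovers V' 0ʷ (incidenceVectors V') ≡⟨ numPerfectMatchings≡exactCovers V' ⟨
  numPerfectMatchings V'                         ∎
  where open ≡-Reasoning

exactCovers-overfull : ∀ {u} V c ds → u ∈ V → 2 ≤ c u → exactCovers V c ds ≡ 0
exactCovers-overfull V c []       u∈V 2≤cu =
  indicator-no (isUnit? V c) (λ unit → 2≰1 (subst (2 ≤_) (All.lookup unit u∈V) 2≤cu))
  where
  2≰1 : ¬ 2 ≤ 1
  2≰1 (s≤s ())
exactCovers-overfull {u} V c (d ∷ ds) u∈V 2≤cu =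
  cong₂ _+_ (exactCovers-overfull V (d ⊕ c) ds u∈V (≤-trans 2≤cu (m≤n+m (c u) (d u))))
            (exactCovers-overfull V c ds u∈V 2≤cu)

exactCovers-uncovered : ∀ {u} V c ds → u ∈ V → c u ≡ 0 → All (λ d → d u ≡ 0) ds → exactCovers V c ds ≡ 0
exactCovers-uncovered V c []       u∈V cu≡0 []              =
  indicator-no (isUnit? V c) (λ unit → 0≢1 (trans (sym cu≡0) (All.lookup unit u∈V)))
  where
  0≢1 : 0 ≢ 1
  0≢1 ()
exactCovers-uncovered V c (d ∷ ds) u∈V cu≡0 (du≡0 ∷ ds≡0) =
  cong₂ _+_ (exactCovers-uncovered V (d ⊕ c) ds u∈V (cong₂ _+_ du≡0 cu≡0) ds≡0)
            (exactCovers-uncovered V c ds u∈V cu≡0 ds≡0)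

exactCovers-++-clashing : ∀ {u} V c As ds → u ∈ V → c u ≡ 1 → All (λ a → a u ≡ 1) As →
  exactCovers V c (As ++ ds) ≡ exactCovers V c ds
exactCovers-++-clashing V c []       ds u∈V cu≡1 []             = refl
exactCovers-++-clashing V c (a ∷ As) ds u∈V cu≡1 (au≡1 ∷ As≡1) =
  cong₂ _+_ (exactCovers-overfull V (a ⊕ c) (As ++ ds) u∈V (≤-reflexive (sym (cong₂ _+_ au≡1 cu≡1))))
            (exactCovers-++-clashing V c As ds u∈V cu≡1 As≡1)

exactCovers-pickOne : ∀ v V c As ds → c v ≡ 0 → All (λ a → a v ≡ 1) As → All (λ d → d v ≡ 0) ds →
  exactCovers (v ∷ V) c (As ++ ds) ≡ sum (map (λ a → exactCovers (v ∷ V) (a ⊕ c) ds) As)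
exactCovers-pickOne v V c []       ds cv≡0 []             ds≡0 = exactCovers-uncovered (v ∷ V) c ds (here refl) cv≡0 ds≡0
exactCovers-pickOne v V c (a ∷ As) ds cv≡0 (av≡1 ∷ As≡1) ds≡0 =
  cong₂ _+_ (exactCovers-++-clashing (v ∷ V) (a ⊕ c) As ds (here refl) (cong₂ _+_ av≡1 cv≡0) As≡1)
            (exactCovers-pickOne v V c As ds cv≡0 As≡1 ds≡0)

exactCovers-∷-covered : ∀ v V c ds → c v ≡ 1 → All (λ d → d v ≡ 0) ds → exactCovers (v ∷ V) c ds ≡ exactCovers V c ds
exactCovers-∷-covered v V c []       cv≡1 []             = indicator-cong (isUnit? (v ∷ V) c) (isUnit? V c) All.tail (cv≡1 ∷_)
exactCovers-∷-covered v V c (d ∷ ds) cv≡1 (dv≡0 ∷ ds≡0) =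
  cong₂ _+_ (exactCovers-∷-covered v V (d ⊕ c) ds (cong₂ _+_ dv≡0 cv≡1) ds≡0)
            (exactCovers-∷-covered v V c ds cv≡1 ds≡0)

_≢?_ : (u w : Sq) → Dec (u ≢ w)
u ≢? w = ¬? (u ≟Sq w)

remove : Sq → List Sq → List Sq
remove w = filter (_≢? w)

remove-∉ : ∀ {w} xs → w ∉ xs → remove w xs ≡ xs
remove-∉ {w} xs w∉xs = filter-all (_≢? w) (All.tabulate λ u∈xs u≡w → w∉xs (subst (_∈ xs) u≡w u∈xs))

remove-middle : ∀ {w} xs ys → w ∉ xs → w ∉ ys → remove w (xs ++ w ∷ ys) ≡ xs ++ ys
remove-middle {w} xs ys w∉xs w∉ys = begin
  remove w (xs ++ w ∷ ys)          ≡⟨ filter-++ (_≢? w) xs (w ∷ ys) ⟩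
  remove w xs ++ remove w (w ∷ ys) ≡⟨ cong₂ _++_ (remove-∉ xs w∉xs) (filter-reject (_≢? w) (λ w≢w → w≢w refl)) ⟩
  xs ++ remove w ys                ≡⟨ cong (xs ++_) (remove-∉ ys w∉ys) ⟩
  xs ++ ys                         ∎
  where open ≡-Reasoning

exactCovers-remove-covered : ∀ w V c ds → c w ≡ 1 → All (λ d → d w ≡ 0) ds →
  exactCovers V c ds ≡ exactCovers (remove w V) c ds
exactCovers-remove-covered w V c []       cw≡1 []             =
  indicator-cong (isUnit? V c) (isUnit? (remove w V) c) (All.filter⁺ (_≢? w))
    (λ unit → All.filter⁻ (_≢? w) unit (All.tabulate λ u∈ → subst (λ u → c u ≡ 1) (sym (removed⇒≡w u∈)) cw≡1))
  where
  removed⇒≡w : ∀ {u} → u ∈ filter (¬? ∘ (_≢? w)) V → u ≡ w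
  removed⇒≡w u∈ = decidable-stable (_ ≟Sq w) (proj₂ (∈-filter⁻ (¬? ∘ (_≢? w)) {xs = V} u∈))
exactCovers-remove-covered w V c (d ∷ ds) cw≡1 (dw≡0 ∷ ds≡0) =
  cong₂ _+_ (exactCovers-remove-covered w V (d ⊕ c) ds (cong₂ _+_ dw≡0 cw≡1) ds≡0)
            (exactCovers-remove-covered w V c ds cw≡1 ds≡0)

exactCovers-filter-disjoint : ∀ {w} V c ds → w ∈ V → c w ≡ 1 →
  exactCovers V c ds ≡ exactCovers V c (filter (λ d → d w ≟ 0) ds)
exactCovers-filter-disjoint     V c []       w∈V cw≡1 = refl
exactCovers-filter-disjoint {w} V c (d ∷ ds) w∈V cw≡1 with d w ≟ 0
... | yes dw≡0 = trans
  (cong₂ _+_ (exactCovers-filter-disjoint V (d ⊕ c) ds w∈V (cong₂ _+_ dw≡0 cw≡1)) (exactCovers-filter-disjoint V c ds w∈V cw≡1))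
  (cong (exactCovers V c) (sym (filter-accept (λ d → d w ≟ 0) {d} {ds} dw≡0)))
... | no dw≢0 = trans
  (cong₂ _+_ (exactCovers-overfull V (d ⊕ c) ds w∈V (+-mono-≤ (n≢0⇒n>0 dw≢0) (≤-reflexive (sym cw≡1))))
             (exactCovers-filter-disjoint V c ds w∈V cw≡1))
  (cong (exactCovers V c) (sym (filter-reject (λ d → d w ≟ 0) {d} {ds} dw≢0)))

pairs-remove : ∀ w V → filter (¬? ∘ incident? w) (pairs V) ≡ pairs (remove w V)
pairs-remove w []       = refl
pairs-remove w (x ∷ xs) with x ≟Sq w
... | yes refl = begin
  filter avoids? (map (w ,_) xs ++ pairs xs)                ≡⟨ filter-++ avoids? (map (w ,_) xs) (pairs xs) ⟩
  filter avoids? (map (w ,_) xs) ++ filter avoids? (pairs xs)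
    ≡⟨ cong₂ _++_ (filter-none avoids? {map (w ,_) xs} (All.map⁺ (All.tabulate λ _ avoid → avoid (inj₁ refl)))) (pairs-remove w xs) ⟩
  pairs (remove w xs)                                       ∎
  where
  open ≡-Reasoning
  avoids? = ¬? ∘ incident? w
... | no x≢w = begin
  filter avoids? (map (x ,_) xs ++ pairs xs)                ≡⟨ filter-++ avoids? (map (x ,_) xs) (pairs xs) ⟩
  filter avoids? (map (x ,_) xs) ++ filter avoids? (pairs xs)
    ≡⟨ cong₂ _++_ (filter-map avoids? (x ,_) xs) (pairs-remove w xs) ⟩
  map (x ,_) (filter (avoids? ∘ (x ,_)) xs) ++ pairs (remove w xs)
    ≡⟨ cong (λ ys → map (x ,_) ys ++ pairs (remove w xs)) (filter-≐ (avoids? ∘ (x ,_)) (_≢? w) (avoid⇒≢ , ≢⇒avoid) xs) ⟩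
  pairs (x ∷ remove w xs)                                   ∎
  where
  open ≡-Reasoning
  avoids? = ¬? ∘ incident? w
  avoid⇒≢ : ∀ {y} → ¬ Incident w (x , y) → ¬ y ≡ w
  avoid⇒≢ avoid y≡w = avoid (inj₂ (sym y≡w))
  ≢⇒avoid : ∀ {y} → ¬ y ≡ w → ¬ Incident w (x , y)
  ≢⇒avoid y≢w = [ x≢w ∘ sym , y≢w ∘ sym ]

incidenceVectors-remove : ∀ w V → filter (λ d → d w ≟ 0) (incidenceVectors V) ≡ incidenceVectors (remove w V)
incidenceVectors-remove w V = begin
  filter (λ d → d w ≟ 0) (map incidence (filter adjacentEdge? (pairs V)))
    ≡⟨ filter-map (λ d → d w ≟ 0) incidence (filter adjacentEdge? (pairs V)) ⟩
  map incidence (filter (λ e → incidence e w ≟ 0) (filter adjacentEdge? (pairs V)))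
    ≡⟨ cong (map incidence) (filter-≐ (λ e → incidence e w ≟ 0) (¬? ∘ incident? w)
         ((λ {e} → indicator≡0⇒¬ (incident? w e)) , λ {e} → indicator-no (incident? w e)) (filter adjacentEdge? (pairs V))) ⟩
  map incidence (filter (¬? ∘ incident? w) (filter adjacentEdge? (pairs V)))
    ≡⟨ cong (map incidence) (filter-comm (¬? ∘ incident? w) adjacentEdge? (pairs V)) ⟩
  map incidence (filter adjacentEdge? (filter (¬? ∘ incident? w) (pairs V)))
    ≡⟨ cong (map incidence ∘ filter adjacentEdge?) (pairs-remove w V) ⟩
  incidenceVectors (remove w V) ∎
  where open ≡-Reasoning

incidenceVectors-vanish : ∀ {v V} → v ∉ V → All (λ d → d v ≡ 0) (incidenceVectors V)
incidenceVectors-vanish {v} {V} v∉V = All.map⁺ {f = incidence} (All.map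
  (λ {e} (a∈ , b∈) → indicator-no (incident? v e) [ ≢-∈ a∈ , ≢-∈ b∈ ])
  (All.filter⁺ adjacentEdge? (pairs-⊆ V)))
  where
  ≢-∈ : ∀ {a} → a ∈ V → v ≢ a
  ≢-∈ a∈ v≡a = v∉V (subst (_∈ V) (sym v≡a) a∈)

exactCovers-matchedEdge : ∀ v V w → v ∉ V → w ∈ V →
  exactCovers (v ∷ V) (incidence (v , w) ⊕ 0ʷ) (incidenceVectors V) ≡ numPerfectMatchings (remove w V)
exactCovers-matchedEdge v V w v∉V w∈V = begin
  exactCovers (v ∷ V) c (incidenceVectors V)
    ≡⟨ exactCovers-∷-covered v V c _ cv≡1 (incidenceVectors-vanish v∉V) ⟩
  exactCovers V c (incidenceVectors V)
    ≡⟨ exactCovers-filter-disjoint V c (incidenceVectors V) w∈V cw≡1 ⟩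
  exactCovers V c (filter (λ d → d w ≟ 0) (incidenceVectors V))
    ≡⟨ cong (exactCovers V c) (incidenceVectors-remove w V) ⟩
  exactCovers V c (incidenceVectors (remove w V))
    ≡⟨ exactCovers-remove-covered w V c _ cw≡1 (incidenceVectors-vanish w∉V-w) ⟩
  exactCovers (remove w V) c (incidenceVectors (remove w V))
    ≡⟨ exactCovers-cong (remove w V) (incidenceVectors (remove w V)) (All.tabulate cu≡0) ⟩
  exactCovers (remove w V) 0ʷ (incidenceVectors (remove w V))
    ≡⟨ numPerfectMatchings≡exactCovers (remove w V) ⟨
  numPerfectMatchings (remove w V) ∎
  where
  open ≡-Reasoning
  c = incidence (v , w) ⊕ 0ʷ
  cv≡1 : c v ≡ 1
  cv≡1 = cong (_+ 0) (indicator-yes (incident? v (v , w)) (inj₁ refl))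
  cw≡1 : c w ≡ 1
  cw≡1 = cong (_+ 0) (indicator-yes (incident? w (v , w)) (inj₂ refl))
  w∉V-w : w ∉ remove w V
  w∉V-w w∈ = proj₂ (∈-filter⁻ (_≢? w) {xs = V} w∈) refl
  cu≡0 : ∀ {u} → u ∈ remove w V → c u ≡ 0
  cu≡0 {u} u∈ with ∈-filter⁻ (_≢? w) {xs = V} u∈
  ... | u∈V , u≢w = cong (_+ 0) (indicator-no (incident? u (v , w)) [ (λ u≡v → v∉V (subst (_∈ V) u≡v u∈V)) , u≢w ])

numPerfectMatchings-∷ : ∀ v V → v ∉ V →
  numPerfectMatchings (v ∷ V) ≡ sum (map (λ w → numPerfectMatchings (remove w V)) (filter (adjacent? v) V))
numPerfectMatchings-∷ v V v∉V = begin
  numPerfectMatchings (v ∷ V)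
    ≡⟨ numPerfectMatchings≡exactCovers (v ∷ V) ⟩
  exactCovers (v ∷ V) 0ʷ (incidenceVectors (v ∷ V))
    ≡⟨ cong (exactCovers (v ∷ V) 0ʷ) (incidenceVectors-∷ v V) ⟩
  exactCovers (v ∷ V) 0ʷ (starVectors v V ++ incidenceVectors V)
    ≡⟨ cong (λ As → exactCovers (v ∷ V) 0ʷ (As ++ incidenceVectors V)) starVectors≡ ⟩
  exactCovers (v ∷ V) 0ʷ (map edgeTo W ++ incidenceVectors V)
    ≡⟨ exactCovers-pickOne v V 0ʷ (map edgeTo W) _ refl
         (All.map⁺ {f = edgeTo} (All.tabulate λ _ → indicator-yes (incident? v _) (inj₁ refl))) (incidenceVectors-vanish v∉V) ⟩
  sum (map (λ a → exactCovers (v ∷ V) (a ⊕ 0ʷ) (incidenceVectors V)) (map edgeTo W))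
    ≡⟨ cong sum (map-∘ W) ⟨
  sum (map (λ w → exactCovers (v ∷ V) (edgeTo w ⊕ 0ʷ) (incidenceVectors V)) W)
    ≡⟨ cong sum (map-cong-local (All.tabulate λ w∈W →
         exactCovers-matchedEdge v V _ v∉V (proj₁ (∈-filter⁻ (adjacent? v) {xs = V} w∈W)))) ⟩
  sum (map (λ w → numPerfectMatchings (remove w V)) W) ∎
  where
  open ≡-Reasoning
  W = filter (adjacent? v) V
  edgeTo : Sq → Weight
  edgeTo w = incidence (v , w)
  starVectors≡ : starVectors v V ≡ map edgeTo W
  starVectors≡ = trans (cong (map incidence) (filter-map adjacentEdge? (v ,_) V)) (sym (map-∘ W))

Apart : Sq → Sq → Set
Apart v u = ¬ Adjacent v u × v ≢ u

filter-adjacent-apart : ∀ {v W} → All (Apart v) W → filter (adjacent? v) W ≡ []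
filter-adjacent-apart {v} apart = filter-none (adjacent? v) (All.map proj₁ apart)

private
  apart⇒∉ : ∀ {v W} → All (Apart v) W → v ∉ W
  apart⇒∉ apart v∈W with All.lookup apart v∈W
  ... | _ , v≢v = v≢v refl

numPerfectMatchings-isolated : ∀ v W → All (Apart v) W → numPerfectMatchings (v ∷ W) ≡ 0
numPerfectMatchings-isolated v W apart =
  trans (numPerfectMatchings-∷ v W (apart⇒∉ apart))
        (cong (λ us → sum (map (λ u → numPerfectMatchings (remove u W)) us)) (filter-adjacent-apart apart))

numPerfectMatchings-pendant : ∀ v w W → Adjacent v w → All (Apart v) W →
  numPerfectMatchings (v ∷ w ∷ W) ≡ numPerfectMatchings W
numPerfectMatchings-pendant v w W v~w apart = begin
  numPerfectMatchings (v ∷ w ∷ W)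
    ≡⟨ numPerfectMatchings-∷ v (w ∷ W) v∉w∷W ⟩
  sum (map (λ u → numPerfectMatchings (remove u (w ∷ W))) (filter (adjacent? v) (w ∷ W)))
    ≡⟨ cong (λ us → sum (map (λ u → numPerfectMatchings (remove u (w ∷ W))) us))
            (trans (filter-accept (adjacent? v) v~w) (cong (w ∷_) (filter-adjacent-apart apart))) ⟩
  numPerfectMatchings (remove w (w ∷ W)) + 0
    ≡⟨ +-identityʳ _ ⟩
  numPerfectMatchings (remove w (w ∷ W))
    ≡⟨ cong numPerfectMatchings (remove-middle [] W (λ ()) w∉W) ⟩
  numPerfectMatchings W ∎
  where
  open ≡-Reasoning
  v∉w∷W : v ∉ w ∷ W
  v∉w∷W (here v≡w)  = adjacent-irrefl w (subst (λ u → Adjacent u w) v≡w v~w)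
  v∉w∷W (there v∈W) = apart⇒∉ apart v∈W
  w∉W : w ∉ W
  w∉W w∈W = proj₁ (All.lookup apart w∈W) v~w

-- The expansion E on a single sequence

applyEs : ∀ {m} → List ℕ → FSum m → FSum m
applyEs ks xs = foldl (λ acc k → lin (Ei k) acc) xs ks

applyEs-[] : ∀ {m} ks → applyEs {m} ks [] ≡ []
applyEs-[] []       = refl
applyEs-[] (k ∷ ks) = applyEs-[] ks

applyEs-++ : ∀ {m} ks (xs ys : FSum m) → applyEs ks (xs ++ ys) ≡ applyEs ks xs ++ applyEs ks ys
applyEs-++ []       xs ys = refl
applyEs-++ (k ∷ ks) xs ys =
  trans (cong (applyEs ks) (concatMap-++ (Ei k) xs ys)) (applyEs-++ ks (lin (Ei k) xs) (lin (Ei k) ys))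

lin-Ei-suc : ∀ {m} k x (xs : FSum m) → lin (Ei (suc k)) (map (x ∷_) xs) ≡ map (x ∷_) (lin (Ei k) xs)
lin-Ei-suc k x []       = refl
lin-Ei-suc k x (v ∷ xs) = cong ((x ∷ v) ∷_) (begin
  singleton? (Maybe.map (x ∷_) (setPair k v)) ++ lin (Ei (suc k)) (map (x ∷_) xs)
    ≡⟨ cong₂ _++_ (singleton?-map (setPair k v)) (lin-Ei-suc k x xs) ⟩
  map (x ∷_) (singleton? (setPair k v)) ++ map (x ∷_) (lin (Ei k) xs)
    ≡⟨ map-++ (x ∷_) (singleton? (setPair k v)) _ ⟨
  map (x ∷_) (singleton? (setPair k v) ++ lin (Ei k) xs) ∎)
  where
  open ≡-Reasoning
  singleton? : ∀ {n} → Maybe (Vec Bool n) → FSum n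
  singleton? = maybe (λ v' → v' ∷ []) []
  singleton?-map : (mv : Maybe (Vec Bool _)) → singleton? (Maybe.map (x ∷_) mv) ≡ map (x ∷_) (singleton? mv)
  singleton?-map (just _) = refl
  singleton?-map nothing  = refl

applyEs-suc : ∀ {m} ks x (xs : FSum m) → applyEs (map suc ks) (map (x ∷_) xs) ≡ map (x ∷_) (applyEs ks xs)
applyEs-suc []       x xs = refl
applyEs-suc (k ∷ ks) x xs = trans (cong (applyEs (map suc ks)) (lin-Ei-suc k x xs)) (applyEs-suc ks x (lin (Ei k) xs))

E-++ : ∀ {m} (xs ys : FSum m) → E (xs ++ ys) ≡ E xs ++ E ys
E-++ {m} = applyEs-++ (upTo (m ∸ 1))

E-[] : ∀ {m} → E {m} [] ≡ []
E-[] {m} = applyEs-[] (upTo (m ∸ 1))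

private
  E-∷-split : ∀ {m} x (τ : Vec Bool m) → E ((x ∷ τ) ∷ []) ≡ applyEs (map suc (upTo (m ∸ 1))) (lin (Ei 0) ((x ∷ τ) ∷ []))
  E-∷-split {zero}  true  [] = refl
  E-∷-split {zero}  false [] = refl
  E-∷-split {suc m} x τ  = cong (λ ks → applyEs ks ((x ∷ τ) ∷ [])) (cong (0 ∷_) (sym (map-upTo suc m)))

E-true∷ : ∀ {m} (τ : Vec Bool m) → E ((true ∷ τ) ∷ []) ≡ map (true ∷_) (E (τ ∷ []))
E-true∷ {m} τ = trans (E-∷-split true τ) (applyEs-suc (upTo (m ∸ 1)) true (τ ∷ []))

-- The terms of E (false ∷ τ) in which E¹ has flipped the leading pair (0,0) to (1,1).
flippedHead : ∀ {m} → Vec Bool m → FSum (suc m)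
flippedHead []          = []
flippedHead (true ∷ τ)  = []
flippedHead (false ∷ τ) = map (true ∷_) (E ((true ∷ τ) ∷ []))

E-false∷ : ∀ {m} (τ : Vec Bool m) → E ((false ∷ τ) ∷ []) ≡ map (false ∷_) (E (τ ∷ [])) ++ flippedHead τ
E-false∷ {zero} []       = refl
E-false∷ {suc m} (true ∷ τ)  =
  trans (E-∷-split false (true ∷ τ)) (trans (applyEs-suc (upTo m) false ((true ∷ τ) ∷ [])) (sym (++-identityʳ _)))
E-false∷ {suc m} (false ∷ τ) = trans (E-∷-split false (false ∷ τ))
  (trans (applyEs-++ (map suc (upTo m)) ((false ∷ false ∷ τ) ∷ []) ((true ∷ true ∷ τ) ∷ []))
    (cong₂ _++_ (applyEs-suc (upTo m) false ((false ∷ τ) ∷ [])) (applyEs-suc (upTo m) true ((true ∷ τ) ∷ []))))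

sum-map-E : ∀ {m} (f : Vec Bool m → ℕ) (xs : FSum m) →
  sum (map f (E xs)) ≡ sum (map (λ τ → sum (map f (E (τ ∷ [])))) xs)
sum-map-E f []       = cong (λ ys → sum (map f ys)) E-[]
sum-map-E f (τ ∷ xs) = begin
  sum (map f (E ((τ ∷ []) ++ xs)))                ≡⟨ cong (λ ys → sum (map f ys)) (E-++ (τ ∷ []) xs) ⟩
  sum (map f (E (τ ∷ []) ++ E xs))                ≡⟨ cong sum (map-++ f (E (τ ∷ [])) (E xs)) ⟩
  sum (map f (E (τ ∷ [])) ++ map f (E xs))        ≡⟨ sum-++ (map f (E (τ ∷ []))) _ ⟩
  sum (map f (E (τ ∷ []))) + sum (map f (E xs))  ≡⟨ cong (λ k → sum (map f (E (τ ∷ []))) + k) (sum-map-E f xs) ⟩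
  sum (map (λ τ → sum (map f (E (τ ∷ [])))) (τ ∷ xs)) ∎
  where open ≡-Reasoning

∣m⊖n∣≡∣m-n∣ : ∀ m n → ℤ.∣ m ⊖ n ∣ ≡ ∣ m - n ∣
∣m⊖n∣≡∣m-n∣ zero    zero    = refl
∣m⊖n∣≡∣m-n∣ zero    (suc n) = refl
∣m⊖n∣≡∣m-n∣ (suc m) zero    = refl
∣m⊖n∣≡∣m-n∣ (suc m) (suc n) = trans (cong ℤ.∣_∣ (ℤ.[1+m]⊖[1+n]≡m⊖n m n)) (∣m⊖n∣≡∣m-n∣ m n)

∣[z-m]-[z-n]∣≡∣m-n∣ : ∀ z m n → ℤ.∣ (z ℤ.- + m) ℤ.- (z ℤ.- + n) ∣ ≡ ∣ m - n ∣
∣[z-m]-[z-n]∣≡∣m-n∣ z m n = begin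
  ℤ.∣ (z ℤ.- + m) ℤ.- (z ℤ.- + n) ∣ ≡⟨ cong ℤ.∣_∣ (cancel z (+ m) (+ n)) ⟩
  ℤ.∣ + n ℤ.- + m ∣                 ≡⟨ cong ℤ.∣_∣ (ℤ.[+m]-[+n]≡m⊖n n m) ⟩
  ℤ.∣ n ⊖ m ∣                       ≡⟨ ∣m⊖n∣≡∣m-n∣ n m ⟩
  ∣ n - m ∣                         ≡⟨ ∣-∣-comm n m ⟩
  ∣ m - n ∣                         ∎
  where
  open ≡-Reasoning
  cancel : ∀ (z p q : ℤ) → (z ℤ.- p) ℤ.- (z ℤ.- q) ≡ q ℤ.- p
  cancel = solve-∀

∣n-1+n∣≡1 : ∀ n → ∣ n - suc n ∣ ≡ 1
∣n-1+n∣≡1 zero    = refl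
∣n-1+n∣≡1 (suc n) = ∣n-1+n∣≡1 n

k≤∣m-n∣ : ∀ {m n k} → m + k ≤ n → k ≤ ∣ m - n ∣
k≤∣m-n∣ {m} {n} m+k≤n = +-cancelˡ-≤ m _ _ (≤-trans m+k≤n (m≤n+∣n-m∣ n m))

distance : Sq → Sq → ℕ
distance (i , j) (i' , j') = ℤ.∣ i ℤ.- i' ∣ + ℤ.∣ j ℤ.- j' ∣

double≡+ : ∀ m → double m ≡ m + m
double≡+ zero    = refl
double≡+ (suc m) = cong suc (trans (cong suc (double≡+ m)) (sym (+-suc m m)))

∣m-n∣+k≤w : ∀ m n k w → m + k ≤ n + w → n + k ≤ m + w → ∣ m - n ∣ + k ≤ w
∣m-n∣+k≤w zero    n       k w _              n+k≤w = n+k≤w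
∣m-n∣+k≤w (suc m) zero    k w m+k≤w          _     = m+k≤w
∣m-n∣+k≤w (suc m) (suc n) k w (s≤s m+k≤n+w) (s≤s n+k≤m+w) = ∣m-n∣+k≤w m n k w m+k≤n+w n+k≤m+w

∣[m-k]∣ : ∀ m k → ℤ.∣ + m ℤ.- + k ∣ ≡ ∣ m - k ∣
∣[m-k]∣ m k = trans (cong ℤ.∣_∣ (ℤ.[+m]-[+n]≡m⊖n m k)) (∣m⊖n∣≡∣m-n∣ m k)

∣[m-k]+1∣ : ∀ m k → ℤ.∣ (+ m ℤ.- + k) ℤ.+ ℤ.1ℤ ∣ ≡ ∣ suc m - k ∣
∣[m-k]+1∣ m k = begin
  ℤ.∣ (+ m ℤ.- + k) ℤ.+ ℤ.1ℤ ∣ ≡⟨ cong (λ z → ℤ.∣ z ℤ.+ ℤ.1ℤ ∣) (ℤ.[+m]-[+n]≡m⊖n m k) ⟩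
  ℤ.∣ (m ⊖ k) ℤ.+ ℤ.1ℤ ∣       ≡⟨ cong ℤ.∣_∣ (ℤ.distribˡ-⊖-+-pos 1 m k) ⟩
  ℤ.∣ (m + 1) ⊖ k ∣            ≡⟨ cong (λ m′ → ℤ.∣ m′ ⊖ k ∣) (+-comm m 1) ⟩
  ℤ.∣ suc m ⊖ k ∣              ≡⟨ ∣m⊖n∣≡∣m-n∣ (suc m) k ⟩
  ∣ suc m - k ∣                ∎
  where open ≡-Reasoning

rangeℤ≡applyUpTo : ∀ lo c → rangeℤ lo c ≡ applyUpTo (λ k → lo ℤ.+ + k) c
rangeℤ≡applyUpTo lo zero    = refl
rangeℤ≡applyUpTo lo (suc c) = cong₂ _∷_ (sym (ℤ.+-identityʳ lo))
  (trans (rangeℤ≡applyUpTo (lo ℤ.+ ℤ.1ℤ) c) (applyUpTo-cong (λ k → ℤ.+-assoc lo ℤ.1ℤ (+ k)) c))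

∈-rangeℤ : ∀ lo {c k} → k < c → lo ℤ.+ + k ∈ rangeℤ lo c
∈-rangeℤ lo {c} k<c = subst (_ ∈_) (sym (rangeℤ≡applyUpTo lo c)) (∈-applyUpTo⁺ (λ k → lo ℤ.+ + k) k<c)

rangeℤ-unique : ∀ lo c → Unique (rangeℤ lo c)
rangeℤ-unique lo c = subst Unique (sym (rangeℤ≡applyUpTo lo c))
  (Unique.applyUpTo⁺₁ _ c λ i<j _ eq → ℕ.<⇒≢ i<j (ℤ.+-injective (+-cancelˡ lo _ _ eq)))

full : ∀ L → Vec Bool L
full L = replicate L false

-- square a b is [X - a, X - a + 1] × [Y - b, Y - b + 1]: columns are counted leftwards, rows downwards.
module Grid (X Y : ℤ) where

  square : ℕ → ℕ → Sq
  square a b = (X ℤ.- + a , Y ℤ.- + b)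

  distance-square : ∀ a b c d → distance (square a b) (square c d) ≡ ∣ a - c ∣ + ∣ b - d ∣
  distance-square a b c d = cong₂ _+_ (∣[z-m]-[z-n]∣≡∣m-n∣ X a c) (∣[z-m]-[z-n]∣≡∣m-n∣ Y b d)

  square-injective : ∀ {a b c d} → square a b ≡ square c d → a ≡ c × b ≡ d
  square-injective {a} {b} {c} {d} eq =
    ∣m-n∣≡0⇒m≡n (m+n≡0⇒m≡0 _ dist≡0) , ∣m-n∣≡0⇒m≡n (m+n≡0⇒n≡0 ∣ a - c ∣ dist≡0)
    where
    dist≡0 : ∣ a - c ∣ + ∣ b - d ∣ ≡ 0
    dist≡0 = begin
      ∣ a - c ∣ + ∣ b - d ∣             ≡⟨ distance-square a b c d ⟨
      distance (square a b) (square c d) ≡⟨ cong (λ u → distance u (square c d)) eq ⟩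
      distance (square c d) (square c d) ≡⟨ distance-square c d c d ⟩
      ∣ c - c ∣ + ∣ d - d ∣             ≡⟨ cong₂ _+_ (∣n-n∣≡0 c) (∣n-n∣≡0 d) ⟩
      0                                 ∎
      where open ≡-Reasoning

  adjacent-square : ∀ {a b c d} → ∣ a - c ∣ + ∣ b - d ∣ ≡ 1 → Adjacent (square a b) (square c d)
  adjacent-square {a} {b} {c} {d} = trans (distance-square a b c d)

  adjacent-below : ∀ a b → Adjacent (square a b) (square a (suc b))
  adjacent-below a b = adjacent-square (cong₂ _+_ (∣n-n∣≡0 a) (∣n-1+n∣≡1 b))

  adjacent-left : ∀ a b → Adjacent (square a b) (square (suc a) b)
  adjacent-left a b = adjacent-square (cong₂ _+_ (∣n-1+n∣≡1 a) (∣n-n∣≡0 b))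

  apart-square : ∀ {a b c d} → 2 ≤ ∣ a - c ∣ + ∣ b - d ∣ → Apart (square a b) (square c d)
  apart-square {a} {b} {c} {d} 2≤dist = adjacent⇒⊥ , equal⇒⊥
    where
    adjacent⇒⊥ : ¬ Adjacent (square a b) (square c d)
    adjacent⇒⊥ adj with subst (2 ≤_) (trans (sym (distance-square a b c d)) adj) 2≤dist
    ... | s≤s ()
    equal⇒⊥ : square a b ≢ square c d
    equal⇒⊥ eq with square-injective eq
    ... | refl , refl with subst (2 ≤_) (cong₂ _+_ (∣n-n∣≡0 a) (∣n-n∣≡0 b)) 2≤dist
    ...   | ()

  -- Column a from row b downwards; a true entry marks a deleted square.
  column : ∀ {m} → ℕ → ℕ → Vec Bool m → List Sq
  column a b []          = []
  column a b (true ∷ v)  = column a (suc b) v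
  column a b (false ∷ v) = square a b ∷ column a (suc b) v

  data InColumn (a lo hi : ℕ) (u : Sq) : Set where
    inColumn : ∀ {d} → lo ≤ d → d < hi → u ≡ square a d → InColumn a lo hi u

  private
    InColumn-raise : ∀ {a b u} m → InColumn a (suc b) (m + suc b) u → InColumn a b (suc m + b) u
    InColumn-raise {b = b} m (inColumn {d} b<d d<hi eq) = inColumn (ℕ.<⇒≤ b<d) (subst (d <_) (ℕ.+-suc m b) d<hi) eq

  column-⊆ : ∀ {m} a b (v : Vec Bool m) → All (InColumn a b (m + b)) (column a b v)
  column-⊆         a b []          = []
  column-⊆ {suc m} a b (true ∷ v)  = All.map (InColumn-raise m) (column-⊆ a (suc b) v)
  column-⊆ {suc m} a b (false ∷ v) = inColumn ℕ.≤-refl (s≤s (ℕ.m≤n+m b m)) refl ∷ All.map (InColumn-raise m) (column-⊆ a (suc b) v)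

  column-apart : ∀ {m a b} c lo (v : Vec Bool m) → (∀ {d} → lo ≤ d → d < m + lo → 2 ≤ ∣ a - c ∣ + ∣ b - d ∣) →
    All (Apart (square a b)) (column c lo v)
  column-apart c lo v far = All.map (λ { (inColumn lo≤d d<hi refl) → apart-square (far lo≤d d<hi) }) (column-⊆ c lo v)

  column-∌ : ∀ {m a b} c lo (v : Vec Bool m) → (∀ {d} → lo ≤ d → ¬ (a ≡ c × b ≡ d)) → square a b ∉ column c lo v
  column-∌ c lo v new ab∈ with All.lookup (column-⊆ c lo v) ab∈
  ... | inColumn lo≤d _ eq = new lo≤d (square-injective eq)

  column-apart-sameBelow : ∀ {m} a b lo (v : Vec Bool m) → 2 + b ≤ lo → All (Apart (square a b)) (column a lo v)
  column-apart-sameBelow a b lo v 2+b≤lo = column-apart a lo v λ {d} lo≤d _ →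
    subst (λ k → 2 ≤ k + ∣ b - d ∣) (sym (∣n-n∣≡0 a)) (k≤∣m-n∣ (subst (_≤ d) (ℕ.+-comm 2 b) (≤-trans 2+b≤lo lo≤d)))

  column-apart-sameAbove : ∀ {m} a c lo (v : Vec Bool m) → m + lo ≤ c → All (Apart (square a (suc c))) (column a lo v)
  column-apart-sameAbove {m} a c lo v m+lo≤c = column-apart a lo v λ {d} _ d<m+lo →
    subst (λ k → 2 ≤ k + ∣ suc c - d ∣) (sym (∣n-n∣≡0 a))
      (subst (2 ≤_) (∣-∣-comm d (suc c)) (k≤∣m-n∣ (subst (_≤ suc c) (ℕ.+-comm 2 d) (s≤s (≤-trans d<m+lo m+lo≤c)))))

  column-apart-nextBelow : ∀ {m} a b lo (v : Vec Bool m) → 1 + b ≤ lo → All (Apart (square a b)) (column (suc a) lo v)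
  column-apart-nextBelow a b lo v 1+b≤lo = column-apart (suc a) lo v λ {d} lo≤d _ →
    subst (λ k → 2 ≤ k + ∣ b - d ∣) (sym (∣n-1+n∣≡1 a))
      (s≤s (k≤∣m-n∣ (subst (_≤ d) (ℕ.+-comm 1 b) (≤-trans 1+b≤lo lo≤d))))

  column-apart-nextAbove : ∀ {m} a c lo (v : Vec Bool m) → m + lo ≤ c → All (Apart (square a c)) (column (suc a) lo v)
  column-apart-nextAbove {m} a c lo v m+lo≤c = column-apart (suc a) lo v λ {d} _ d<m+lo →
    subst (λ k → 2 ≤ k + ∣ c - d ∣) (sym (∣n-1+n∣≡1 a))
      (s≤s (subst (1 ≤_) (∣-∣-comm d c) (k≤∣m-n∣ (subst (_≤ c) (ℕ.+-comm 1 d) (≤-trans d<m+lo m+lo≤c)))))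

  column-unique : ∀ {m} a b (v : Vec Bool m) → Unique (column a b v)
  column-unique a b []          = []
  column-unique a b (true ∷ v)  = column-unique a (suc b) v
  column-unique a b (false ∷ v) =
    All.map (λ { (inColumn b<d _ refl) eq → ℕ.<-irrefl (proj₂ (square-injective eq)) b<d }) (column-⊆ a (suc b) v)
    ∷ column-unique a (suc b) v

  -- Transfer between two adjacent columns

  data Beyond (a b : ℕ) (u : Sq) : Set where
    farColumn : ∀ {c d} → 2 + a ≤ c → u ≡ square c d → Beyond a b u
    above     : ∀ {d} → d < b → u ≡ square (suc a) d → Beyond a b u

  Beyond-raise : ∀ {a b u} → Beyond a b u → Beyond a (suc b) u
  Beyond-raise (farColumn 2+a≤c eq) = farColumn 2+a≤c eq
  Beyond-raise (above d<b eq)       = above (ℕ.m≤n⇒m≤1+n d<b) eq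

  Beyond-apart : ∀ {a b b' u} → b ≤ b' → Beyond a b u → Apart (square a b') u
  Beyond-apart {a} {b} {b'} b≤b' (farColumn {c} {d} 2+a≤c refl) =
    apart-square (≤-trans (k≤∣m-n∣ (subst (_≤ c) (+-comm 2 a) 2+a≤c)) (m≤m+n _ _))
  Beyond-apart {a} {b} {b'} b≤b' (above {d} d<b refl) =
    apart-square (subst (λ k → 2 ≤ k + ∣ b' - d ∣) (sym (∣n-1+n∣≡1 a))
      (s≤s (subst (1 ≤_) (∣-∣-comm d b') (k≤∣m-n∣ (subst (_≤ b') (+-comm 1 d) (≤-trans d<b b≤b'))))))

  Beyond-∌-left : ∀ {a b u} → Beyond a b u → u ≢ square (suc a) b
  Beyond-∌-left (farColumn 2+a≤c eq) eq' with square-injective (trans (sym eq) eq')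
  ... | refl , _ = ℕ.<-irrefl refl 2+a≤c
  Beyond-∌-left (above d<b eq) eq' with square-injective (trans (sym eq) eq')
  ... | _ , refl = ℕ.<-irrefl refl d<b

  -- Perfect matchings left once the squares of column a in the rows where ρ is false have been
  -- matched horizontally into column a + 1 (whose pattern is σ, from row b on).
  afterTransfer : ∀ {L} → ℕ → Vec Bool L → Vec Bool L → ℕ → List Sq → ℕ
  afterTransfer a []          []          b W = numPerfectMatchings W
  afterTransfer a (true ∷ ρ)  (c ∷ σ)     b W = afterTransfer a ρ σ (suc b) (column (suc a) b (c ∷ []) ++ W)
  afterTransfer a (false ∷ ρ) (true ∷ σ)  b W = 0
  afterTransfer a (false ∷ ρ) (false ∷ σ) b W = afterTransfer a ρ σ (suc b) W

  ColumnTransfer : ∀ {L} → ℕ → Vec Bool L → Set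
  ColumnTransfer {L} a τ = ∀ b (σ : Vec Bool L) W → All (Beyond a b) W →
    numPerfectMatchings (column a b τ ++ column (suc a) b σ ++ W) ≡ sum (map (λ ρ → afterTransfer a ρ σ b W) (E (τ ∷ [])))

  column-∷ : ∀ {L} a b c (σ : Vec Bool L) → column a b (c ∷ σ) ≡ column a b (c ∷ []) ++ column a (suc b) σ
  column-∷ a b true  σ = refl
  column-∷ a b false σ = refl

  numPerfectMatchings-lowerTop : ∀ {L} A a b c (σ : Vec Bool L) W →
    numPerfectMatchings (A ++ column a b (c ∷ σ) ++ W) ≡ numPerfectMatchings (A ++ column a (suc b) σ ++ column a b (c ∷ []) ++ W)
  numPerfectMatchings-lowerTop A a b c σ W = numPerfectMatchings-↭ (++⁺ˡ A (begin
    column a b (c ∷ σ) ++ W                           ≡⟨ cong (_++ W) (column-∷ a b c σ) ⟩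
    (column a b (c ∷ []) ++ column a (suc b) σ) ++ W  ≡⟨ ++-assoc (column a b (c ∷ [])) _ W ⟩
    column a b (c ∷ []) ++ column a (suc b) σ ++ W    ↭⟨ shifts (column a b (c ∷ [])) (column a (suc b) σ) ⟩
    column a (suc b) σ ++ column a b (c ∷ []) ++ W    ∎))
    where open PermutationReasoning

  Beyond-lowerTop : ∀ {a b W} c → All (Beyond a b) W → All (Beyond a (suc b)) (column (suc a) b (c ∷ []) ++ W)
  Beyond-lowerTop true  W-beyond = All.map Beyond-raise W-beyond
  Beyond-lowerTop false W-beyond = above ℕ.≤-refl refl ∷ All.map Beyond-raise W-beyond

  columnTransfer-true : ∀ {L} a (τ : Vec Bool L) → ColumnTransfer a τ → ColumnTransfer a (true ∷ τ)
  columnTransfer-true a τ transfer b (c ∷ σ) W W-beyond = begin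
    numPerfectMatchings (column a (suc b) τ ++ column (suc a) b (c ∷ σ) ++ W)
      ≡⟨ numPerfectMatchings-lowerTop (column a (suc b) τ) (suc a) b c σ W ⟩
    numPerfectMatchings (column a (suc b) τ ++ column (suc a) (suc b) σ ++ W′)
      ≡⟨ transfer (suc b) σ W′ (Beyond-lowerTop c W-beyond) ⟩
    sum (map (λ ρ → afterTransfer a ρ σ (suc b) W′) (E (τ ∷ [])))
      ≡⟨ sum-map-map (λ ρ → afterTransfer a ρ (c ∷ σ) b W) (true ∷_) (E (τ ∷ [])) ⟨
    sum (map (λ ρ → afterTransfer a ρ (c ∷ σ) b W) (map (true ∷_) (E (τ ∷ []))))
      ≡⟨ cong (λ ρs → sum (map (λ ρ → afterTransfer a ρ (c ∷ σ) b W) ρs)) (E-true∷ τ) ⟨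
    sum (map (λ ρ → afterTransfer a ρ (c ∷ σ) b W) (E ((true ∷ τ) ∷ []))) ∎
    where
    open ≡-Reasoning
    W′ = column (suc a) b (c ∷ []) ++ W

  belowOf : ∀ {L} → ℕ → ℕ → Vec Bool L → List Sq
  belowOf a b (false ∷ _) = square a (suc b) ∷ []
  belowOf a b _           = []

  leftOf : ∀ {L} → ℕ → ℕ → Vec Bool L → List Sq
  leftOf a b (false ∷ _) = square (suc a) b ∷ []
  leftOf a b _           = []

  neighbours-below : ∀ {L} a b (τ : Vec Bool L) → filter (adjacent? (square a b)) (column a (suc b) τ) ≡ belowOf a b τ
  neighbours-below a b []          = refl
  neighbours-below a b (true ∷ τ)  = filter-adjacent-apart (column-apart-sameBelow a b (2 + b) τ ℕ.≤-refl)
  neighbours-below a b (false ∷ τ) =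
    trans (filter-accept (adjacent? (square a b)) (adjacent-below a b))
          (cong (_ ∷_) (filter-adjacent-apart (column-apart-sameBelow a b (2 + b) τ ℕ.≤-refl)))

  neighbours-left : ∀ {L} a b (σ : Vec Bool L) → filter (adjacent? (square a b)) (column (suc a) b σ) ≡ leftOf a b σ
  neighbours-left a b []          = refl
  neighbours-left a b (true ∷ σ)  = filter-adjacent-apart (column-apart-nextBelow a b (1 + b) σ ℕ.≤-refl)
  neighbours-left a b (false ∷ σ) =
    trans (filter-accept (adjacent? (square a b)) (adjacent-left a b))
          (cong (_ ∷_) (filter-adjacent-apart (column-apart-nextBelow a b (1 + b) σ ℕ.≤-refl)))

  neighbours-corner : ∀ {L} a b (τ : Vec Bool L) (σ : Vec Bool (suc L)) W → All (Beyond a b) W →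
    filter (adjacent? (square a b)) (column a (suc b) τ ++ column (suc a) b σ ++ W) ≡ belowOf a b τ ++ leftOf a b σ
  neighbours-corner a b τ σ W W-beyond = begin
    filter adj? (column a (suc b) τ ++ column (suc a) b σ ++ W)
      ≡⟨ filter-++ adj? (column a (suc b) τ) _ ⟩
    filter adj? (column a (suc b) τ) ++ filter adj? (column (suc a) b σ ++ W)
      ≡⟨ cong (filter adj? (column a (suc b) τ) ++_) (filter-++ adj? (column (suc a) b σ) W) ⟩
    filter adj? (column a (suc b) τ) ++ filter adj? (column (suc a) b σ) ++ filter adj? W
      ≡⟨ cong₂ (λ xs ys → xs ++ ys ++ filter adj? W) (neighbours-below a b τ) (neighbours-left a b σ) ⟩
    belowOf a b τ ++ leftOf a b σ ++ filter adj? W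
      ≡⟨ cong (λ zs → belowOf a b τ ++ leftOf a b σ ++ zs) (filter-adjacent-apart (All.map (Beyond-apart ℕ.≤-refl) W-beyond)) ⟩
    belowOf a b τ ++ leftOf a b σ ++ []
      ≡⟨ cong (belowOf a b τ ++_) (++-identityʳ (leftOf a b σ)) ⟩
    belowOf a b τ ++ leftOf a b σ ∎
    where
    open ≡-Reasoning
    adj? = adjacent? (square a b)

  square-∉-columnPair : ∀ {L L'} a b b' lo (τ : Vec Bool L) (σ : Vec Bool L') W → All (Beyond a b) W → b' < lo → b ≤ b' →
    square a b' ∉ column a lo τ ++ column (suc a) b σ ++ W
  square-∉-columnPair a b b' lo τ σ W W-beyond b'<lo b≤b' u∈ with ∈-++⁻ (column a lo τ) u∈
  ... | inj₁ u∈columnA = column-∌ a lo τ (λ lo≤d (_ , b'≡d) → ℕ.<-irrefl b'≡d (≤-trans b'<lo lo≤d)) u∈columnA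
  ... | inj₂ u∈rest with ∈-++⁻ (column (suc a) b σ) u∈rest
  ...   | inj₁ u∈columnB = column-∌ (suc a) b σ (λ _ (a≡1+a , _) → ℕ.1+n≢n (sym a≡1+a)) u∈columnB
  ...   | inj₂ u∈W       = proj₂ (Beyond-apart b≤b' (All.lookup W-beyond u∈W)) refl

  columnTransfer : ∀ {L} a (τ : Vec Bool L) → ColumnTransfer a τ

  transfer-left : ∀ {L} a b (τ : Vec Bool L) σ W → All (Beyond a b) W →
    sum (map (λ w → numPerfectMatchings (remove w (column a (suc b) τ ++ column (suc a) b σ ++ W))) (leftOf a b σ))
      ≡ sum (map (λ ρ → afterTransfer a ρ σ b W) (map (false ∷_) (E (τ ∷ []))))
  transfer-left a b τ (true ∷ σ)  W W-beyond = sym (trans (sum-map-map _ (false ∷_) (E (τ ∷ []))) (sum-map-0 (E (τ ∷ []))))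
  transfer-left a b τ (false ∷ σ) W W-beyond = begin
    numPerfectMatchings (remove (square (suc a) b) (column a (suc b) τ ++ square (suc a) b ∷ column (suc a) (suc b) σ ++ W)) + 0
      ≡⟨ +-identityʳ _ ⟩
    numPerfectMatchings (remove (square (suc a) b) (column a (suc b) τ ++ square (suc a) b ∷ column (suc a) (suc b) σ ++ W))
      ≡⟨ cong numPerfectMatchings (remove-middle (column a (suc b) τ) _ ∉columnA ∉rest) ⟩
    numPerfectMatchings (column a (suc b) τ ++ column (suc a) (suc b) σ ++ W)
      ≡⟨ columnTransfer a τ (suc b) σ W (All.map Beyond-raise W-beyond) ⟩
    sum (map (λ ρ → afterTransfer a ρ σ (suc b) W) (E (τ ∷ [])))
      ≡⟨ sum-map-map (λ ρ → afterTransfer a ρ (false ∷ σ) b W) (false ∷_) (E (τ ∷ [])) ⟨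
    sum (map (λ ρ → afterTransfer a ρ (false ∷ σ) b W) (map (false ∷_) (E (τ ∷ [])))) ∎
    where
    open ≡-Reasoning
    ∉columnA : square (suc a) b ∉ column a (suc b) τ
    ∉columnA = column-∌ a (suc b) τ λ _ (1+a≡a , _) → ℕ.1+n≢n 1+a≡a
    ∉rest : square (suc a) b ∉ column (suc a) (suc b) σ ++ W
    ∉rest w∈ with ∈-++⁻ (column (suc a) (suc b) σ) w∈
    ... | inj₁ w∈column = column-∌ (suc a) (suc b) σ (λ b<d (_ , b≡d) → ℕ.<-irrefl b≡d b<d) w∈column
    ... | inj₂ w∈W      = Beyond-∌-left (All.lookup W-beyond w∈W) refl

  transfer-below : ∀ {L} a b (τ : Vec Bool L) σ W → All (Beyond a b) W →
    sum (map (λ w → numPerfectMatchings (remove w (column a (suc b) τ ++ column (suc a) b σ ++ W))) (belowOf a b τ))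
      ≡ sum (map (λ ρ → afterTransfer a ρ σ b W) (flippedHead τ))
  transfer-below a b []          σ       W W-beyond = refl
  transfer-below a b (true ∷ τ)  σ       W W-beyond = refl
  transfer-below a b (false ∷ τ) (c ∷ σ) W W-beyond = begin
    numPerfectMatchings (remove (square a (suc b)) (square a (suc b) ∷ column a (2 + b) τ ++ column (suc a) b (c ∷ σ) ++ W)) + 0
      ≡⟨ +-identityʳ _ ⟩
    numPerfectMatchings (remove (square a (suc b)) (square a (suc b) ∷ column a (2 + b) τ ++ column (suc a) b (c ∷ σ) ++ W))
      ≡⟨ cong numPerfectMatchings (remove-middle [] _ (λ ())
           (square-∉-columnPair a b (suc b) (2 + b) τ (c ∷ σ) W W-beyond ℕ.≤-refl (ℕ.n≤1+n b))) ⟩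
    numPerfectMatchings (column a (2 + b) τ ++ column (suc a) b (c ∷ σ) ++ W)
      ≡⟨ numPerfectMatchings-lowerTop (column a (2 + b) τ) (suc a) b c σ W ⟩
    numPerfectMatchings (column a (suc b) (true ∷ τ) ++ column (suc a) (suc b) σ ++ W′)
      ≡⟨ columnTransfer-true a τ (columnTransfer a τ) (suc b) σ W′ (Beyond-lowerTop c W-beyond) ⟩
    sum (map (λ ρ → afterTransfer a ρ σ (suc b) W′) (E ((true ∷ τ) ∷ [])))
      ≡⟨ sum-map-map (λ ρ → afterTransfer a ρ (c ∷ σ) b W) (true ∷_) (E ((true ∷ τ) ∷ [])) ⟨
    sum (map (λ ρ → afterTransfer a ρ (c ∷ σ) b W) (map (true ∷_) (E ((true ∷ τ) ∷ [])))) ∎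
    where
    open ≡-Reasoning
    W′ = column (suc a) b (c ∷ []) ++ W

  columnTransfer a []          b []      W W-beyond = sym (+-identityʳ _)
  columnTransfer a (true ∷ τ)  = columnTransfer-true a τ (columnTransfer a τ)
  -- The corner square (a , b) is matched either downwards, inside column a, or leftwards, into column a + 1.
  columnTransfer a (false ∷ τ) b σ       W W-beyond = begin
    numPerfectMatchings (square a b ∷ V)
      ≡⟨ numPerfectMatchings-∷ (square a b) V (square-∉-columnPair a b b (suc b) τ σ W W-beyond ℕ.≤-refl ℕ.≤-refl) ⟩
    sum (map f (filter (adjacent? (square a b)) V))
      ≡⟨ cong (sum ∘ map f) (neighbours-corner a b τ σ W W-beyond) ⟩
    sum (map f (belowOf a b τ ++ leftOf a b σ))
      ≡⟨ sum-map-++ f (belowOf a b τ) (leftOf a b σ) ⟩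
    sum (map f (belowOf a b τ)) + sum (map f (leftOf a b σ))
      ≡⟨ cong₂ _+_ (transfer-below a b τ σ W W-beyond) (transfer-left a b τ σ W W-beyond) ⟩
    sum (map g (flippedHead τ)) + sum (map g (map (false ∷_) (E (τ ∷ []))))
      ≡⟨ +-comm (sum (map g (flippedHead τ))) _ ⟩
    sum (map g (map (false ∷_) (E (τ ∷ [])))) + sum (map g (flippedHead τ))
      ≡⟨ sum-map-++ g (map (false ∷_) (E (τ ∷ []))) (flippedHead τ) ⟨
    sum (map g (map (false ∷_) (E (τ ∷ [])) ++ flippedHead τ))
      ≡⟨ cong (sum ∘ map g) (E-false∷ τ) ⟨
    sum (map g (E ((false ∷ τ) ∷ []))) ∎
    where
    open ≡-Reasoning
    V = column a (suc b) τ ++ column (suc a) b σ ++ W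
    f : Sq → ℕ
    f w = numPerfectMatchings (remove w V)
    g : Vec Bool _ → ℕ
    g ρ = afterTransfer a ρ σ b W

  afterTransfer-full : ∀ {L} a (ρ : Vec Bool L) b W →
    afterTransfer a ρ (full L) b W ≡ numPerfectMatchings (column (suc a) b (Defs.R ρ) ++ W)
  afterTransfer-full a []          b W = refl
  afterTransfer-full a (true ∷ ρ)  b W =
    trans (afterTransfer-full a ρ (suc b) (square (suc a) b ∷ W))
          (numPerfectMatchings-↭ (shift (square (suc a) b) (column (suc a) (suc b) (Defs.R ρ)) W))
  afterTransfer-full a (false ∷ ρ) b W = afterTransfer-full a ρ (suc b) W

  private
    column-lower : ∀ {m k} a b (u : Vec Bool m) (w : Vec Bool k) →
      column a (suc b) u ++ column a (m + suc b) w ≡ column a (suc b) u ++ column a (suc m + b) w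
    column-lower {m} a b u w = cong (λ r → column a (suc b) u ++ column a r w) (+-suc m b)

  column-∷ʳ : ∀ {m} a b (u : Vec Bool m) x → column a b (u ∷ʳ x) ≡ column a b u ++ column a (m + b) (x ∷ [])
  column-∷ʳ a b []          x = refl
  column-∷ʳ a b (true ∷ u)  x = trans (column-∷ʳ a (suc b) u x) (column-lower a b u (x ∷ []))
  column-∷ʳ a b (false ∷ u) x = cong (square a b ∷_) (trans (column-∷ʳ a (suc b) u x) (column-lower a b u (x ∷ [])))

  column-splitLast2 : ∀ {m} a b (v : Vec Bool (2 + m)) → let (u , x , y) = splitLast2 v in
    column a b v ≡ column a b u ++ column a (m + b) (x ∷ y ∷ [])
  column-splitLast2 {zero}  a b (x ∷ y ∷ []) = refl
  column-splitLast2 {suc m} a b (x ∷ v) with splitLast2 v | column-splitLast2 a (suc b) v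
  ... | u , y , z | split with x
  ...   | true  = trans split (column-lower a b u (y ∷ z ∷ []))
  ...   | false = cong (square a b ∷_) (trans split (column-lower a b u (y ∷ z ∷ [])))

  numPerfectMatchings-topPair : ∀ a b e₁ e₂ W → All (Apart (square a b)) W →
    numPerfectMatchings (column a b (e₁ ∷ e₂ ∷ []) ++ W)
      ≡ maybe′ (λ e → numPerfectMatchings (column a (suc b) (e ∷ []) ++ W)) 0 (aCode e₁ e₂)
  numPerfectMatchings-topPair a b true  true  W apart = refl
  numPerfectMatchings-topPair a b true  false W apart = refl
  numPerfectMatchings-topPair a b false true  W apart = numPerfectMatchings-isolated (square a b) W apart
  numPerfectMatchings-topPair a b false false W apart =
    numPerfectMatchings-pendant (square a b) (square a (suc b)) W (adjacent-below a b) apart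

  numPerfectMatchings-bottomPair : ∀ a c e₃ e₄ U W → All (Apart (square a (suc c))) (U ++ W) →
    numPerfectMatchings (U ++ column a c (e₃ ∷ e₄ ∷ []) ++ W)
      ≡ maybe′ (λ e → numPerfectMatchings (U ++ column a c (e ∷ []) ++ W)) 0 (bCode e₃ e₄)
  numPerfectMatchings-bottomPair a c true  true  U W apart = refl
  numPerfectMatchings-bottomPair a c false true  U W apart = refl
  numPerfectMatchings-bottomPair a c true  false U W apart =
    trans (numPerfectMatchings-↭ (shift (square a (suc c)) U W)) (numPerfectMatchings-isolated (square a (suc c)) (U ++ W) apart)
  numPerfectMatchings-bottomPair a c false false U W apart =
    trans (numPerfectMatchings-↭ bottomFirst)
          (numPerfectMatchings-pendant (square a (suc c)) (square a c) (U ++ W)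
            (adjacent-sym (square a c) _ (adjacent-below a c)) apart)
    where
    bottomFirst : U ++ square a c ∷ square a (suc c) ∷ W ↭ square a (suc c) ∷ square a c ∷ U ++ W
    bottomFirst = begin
      U ++ square a c ∷ square a (suc c) ∷ W    ↭⟨ shift (square a c) U _ ⟩
      square a c ∷ U ++ square a (suc c) ∷ W    ↭⟨ ↭.prep (square a c) (shift (square a (suc c)) U W) ⟩
      square a c ∷ square a (suc c) ∷ U ++ W    ↭⟨ ↭.swap (square a c) (square a (suc c)) ↭.↭-refl ⟩
      square a (suc c) ∷ square a c ∷ U ++ W    ∎
      where open PermutationReasoning

  private
    column-pair : ∀ {m} a b e₁ e₂ (v : Vec Bool m) →
      column a b (e₁ ∷ e₂ ∷ v) ≡ column a b (e₁ ∷ e₂ ∷ []) ++ column a (2 + b) v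
    column-pair a b true  true  v = refl
    column-pair a b true  false v = refl
    column-pair a b false true  v = refl
    column-pair a b false false v = refl

    regroupTop : ∀ {m} a b e₁ e₂ (v : Vec Bool m) W →
      numPerfectMatchings (column a b (e₁ ∷ e₂ ∷ v) ++ W)
        ≡ numPerfectMatchings (column a b (e₁ ∷ e₂ ∷ []) ++ column a (2 + b) v ++ W)
    regroupTop a b e₁ e₂ v W =
      cong numPerfectMatchings (trans (cong (_++ W) (column-pair a b e₁ e₂ v)) (++-assoc (column a b (e₁ ∷ e₂ ∷ [])) _ W))

    maybe-cong : ∀ {A : Set} {f g : A → ℕ} → (∀ x → f x ≡ g x) → ∀ mx → maybe′ f 0 mx ≡ maybe′ g 0 mx
    maybe-cong f≡g (just x) = f≡g x
    maybe-cong f≡g nothing  = refl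

    K-bottom : ∀ {m} a b e (v : Vec Bool (2 + m)) u e₃ e₄ W →
      column a (2 + b) v ≡ column a (2 + b) u ++ column a (m + (2 + b)) (e₃ ∷ e₄ ∷ []) →
      All (Apart (square a (suc (m + (2 + b))))) W →
      numPerfectMatchings (column a (suc b) (e ∷ []) ++ column a (2 + b) v ++ W)
        ≡ maybe′ (λ e′ → numPerfectMatchings (column a (suc b) (e ∷ (u ∷ʳ e′)) ++ W)) 0 (bCode e₃ e₄)
    K-bottom {m} a b e v u e₃ e₄ W split bottom-apart = begin
      numPerfectMatchings (column a (suc b) (e ∷ []) ++ column a (2 + b) v ++ W)
        ≡⟨ cong (λ xs → numPerfectMatchings (column a (suc b) (e ∷ []) ++ xs ++ W)) split ⟩
      numPerfectMatchings (column a (suc b) (e ∷ []) ++ (column a (2 + b) u ++ column a c (e₃ ∷ e₄ ∷ [])) ++ W)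
        ≡⟨ cong numPerfectMatchings (regroup (column a c (e₃ ∷ e₄ ∷ []))) ⟩
      numPerfectMatchings (U ++ column a c (e₃ ∷ e₄ ∷ []) ++ W)
        ≡⟨ numPerfectMatchings-bottomPair a c e₃ e₄ U W (All.++⁺ U-apart bottom-apart) ⟩
      maybe′ (λ e′ → numPerfectMatchings (U ++ column a c (e′ ∷ []) ++ W)) 0 (bCode e₃ e₄)
        ≡⟨ maybe-cong (λ e′ → cong numPerfectMatchings (reassemble e′)) (bCode e₃ e₄) ⟨
      maybe′ (λ e′ → numPerfectMatchings (column a (suc b) (e ∷ (u ∷ʳ e′)) ++ W)) 0 (bCode e₃ e₄) ∎
      where
      open ≡-Reasoning
      c = m + (2 + b)
      U = column a (suc b) (e ∷ []) ++ column a (2 + b) u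
      U-apart : All (Apart (square a (suc c))) U
      U-apart = All.++⁺ (column-apart-sameAbove a c (suc b) (e ∷ []) (ℕ.m≤n+m (2 + b) m)) (column-apart-sameAbove a c (2 + b) u ℕ.≤-refl)
      regroup : ∀ B → column a (suc b) (e ∷ []) ++ (column a (2 + b) u ++ B) ++ W ≡ U ++ B ++ W
      regroup B = trans (cong (column a (suc b) (e ∷ []) ++_) (++-assoc (column a (2 + b) u) B W))
                        (sym (++-assoc (column a (suc b) (e ∷ [])) _ _))
      reassemble : ∀ e′ → column a (suc b) (e ∷ (u ∷ʳ e′)) ++ W ≡ U ++ column a c (e′ ∷ []) ++ W
      reassemble e′ = begin
        column a (suc b) (e ∷ (u ∷ʳ e′)) ++ W
          ≡⟨ cong (_++ W) (column-∷ a (suc b) e (u ∷ʳ e′)) ⟩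
        (column a (suc b) (e ∷ []) ++ column a (2 + b) (u ∷ʳ e′)) ++ W
          ≡⟨ ++-assoc (column a (suc b) (e ∷ [])) _ W ⟩
        column a (suc b) (e ∷ []) ++ column a (2 + b) (u ∷ʳ e′) ++ W
          ≡⟨ cong (λ xs → column a (suc b) (e ∷ []) ++ xs ++ W) (column-∷ʳ a (2 + b) u e′) ⟩
        column a (suc b) (e ∷ []) ++ (column a (2 + b) u ++ column a c (e′ ∷ [])) ++ W
          ≡⟨ regroup (column a c (e′ ∷ [])) ⟩
        U ++ column a c (e′ ∷ []) ++ W ∎

  -- The top and the bottom square of column a have no neighbour in W; K records how they are matched.
  numPerfectMatchings-K : ∀ {m} a b (ε : Vec Bool (4 + m)) W →
    All (Apart (square a b)) W → All (Apart (square a (suc (m + (2 + b))))) W →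
    numPerfectMatchings (column a b ε ++ W) ≡ sum (map (λ τ → numPerfectMatchings (column a (suc b) τ ++ W)) (K ε))
  numPerfectMatchings-K {m} a b (e₁ ∷ e₂ ∷ v) W top-apart bottom-apart
    with splitLast2 v | column-splitLast2 a (2 + b) v | aCode e₁ e₂
       | numPerfectMatchings-topPair a b e₁ e₂ (column a (2 + b) v ++ W) (All.++⁺ (column-apart-sameBelow a b (2 + b) v ℕ.≤-refl) top-apart)
  ... | u , e₃ , e₄ | split | nothing | top = trans (regroupTop a b e₁ e₂ v W) top
  ... | u , e₃ , e₄ | split | just e  | top with bCode e₃ e₄ | K-bottom a b e v u e₃ e₄ W split bottom-apart
  ...   | nothing | bottom = trans (regroupTop a b e₁ e₂ v W) (trans top bottom)
  ...   | just e′ | bottom = trans (regroupTop a b e₁ e₂ v W) (trans top (trans bottom (sym (+-identityʳ _))))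

  -- Columns a, a+1, … of a half diamond: column a has 2k rows from row b and deletion pattern ε,
  -- and each further column starts one row lower, is two rows shorter, and is complete.
  staircase : (k : ℕ) → ℕ → ℕ → Vec Bool (double k) → List Sq
  staircase zero    a b [] = []
  staircase (suc k) a b ε  = column a b ε ++ staircase k (suc a) (suc b) (full (double k))

  staircase-⊆ : ∀ k a b ε → All (λ u → ∃₂ λ c d → a ≤ c × u ≡ square c d) (staircase k a b ε)
  staircase-⊆ zero    a b [] = []
  staircase-⊆ (suc k) a b ε  = All.++⁺ (All.map (λ { (inColumn {d} _ _ eq) → a , d , ℕ.≤-refl , eq }) (column-⊆ a b ε))
    (All.map (λ (c , d , 1+a≤c , eq) → c , d , ℕ.<⇒≤ 1+a≤c , eq) (staircase-⊆ k (suc a) (suc b) _))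

  staircase-beyond : ∀ k {a a'} b b' ε → 2 + a ≤ a' → All (Beyond a b') (staircase k a' b ε)
  staircase-beyond k b b' ε 2+a≤a' = All.map (λ (_ , _ , a'≤c , eq) → farColumn (≤-trans 2+a≤a' a'≤c) eq) (staircase-⊆ k _ b ε)

  numPerfectMatchings-staircase : ∀ k a b (ε : Vec Bool (double (suc k))) → numPerfectMatchings (staircase (suc k) a b ε) ≡ C (suc k) ε
  numPerfectMatchings-staircase zero a b (true  ∷ true  ∷ []) = refl
  numPerfectMatchings-staircase zero a b (true  ∷ false ∷ []) = numPerfectMatchings-isolated (square a (suc b)) [] []
  numPerfectMatchings-staircase zero a b (false ∷ true  ∷ []) = numPerfectMatchings-isolated (square a b) [] []
  numPerfectMatchings-staircase zero a b (false ∷ false ∷ []) =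
    numPerfectMatchings-pendant (square a b) (square a (suc b)) [] (adjacent-below a b) []
  numPerfectMatchings-staircase (suc m) a b ε = begin
    numPerfectMatchings (column a b ε ++ B)
      ≡⟨ numPerfectMatchings-K a b ε B top-apart bottom-apart ⟩
    sum (map (λ τ → numPerfectMatchings (column a (suc b) τ ++ B)) (K ε))
      ≡⟨ cong sum (map-cong transferColumn (K ε)) ⟩
    sum (map (λ τ → sum (map (C (suc m) ∘ Defs.R) (E (τ ∷ [])))) (K ε))
      ≡⟨ sum-map-E (C (suc m) ∘ Defs.R) (K ε) ⟨
    sum (map (C (suc m) ∘ Defs.R) (E (K ε)))
      ≡⟨ sum-map-map (C (suc m)) Defs.R (E (K ε)) ⟨
    C (suc (suc m)) ε ∎
    where
    open ≡-Reasoning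
    Rest = staircase m (2 + a) (2 + b) (full (double m))
    B = column (suc a) (suc b) (full (2 + double m)) ++ Rest
    Rest-beyond : ∀ b' → All (Beyond a b') Rest
    Rest-beyond b' = staircase-beyond m (2 + b) b' _ ℕ.≤-refl
    top-apart : All (Apart (square a b)) B
    top-apart = All.++⁺ (column-apart-nextBelow a b (suc b) (full (2 + double m)) ℕ.≤-refl) (All.map (Beyond-apart z≤n) (Rest-beyond 0))
    bottom-apart : All (Apart (square a (suc (double m + (2 + b))))) B
    bottom-apart = All.++⁺
      (column-apart-nextAbove a _ (suc b) (full (2 + double m)) (ℕ.≤-reflexive (cong suc (sym (+-suc (double m) (suc b))))))
                           (All.map (Beyond-apart z≤n) (Rest-beyond 0))
    transferColumn : ∀ τ → numPerfectMatchings (column a (suc b) τ ++ B) ≡ sum (map (C (suc m) ∘ Defs.R) (E (τ ∷ [])))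
    transferColumn τ = trans (columnTransfer a τ (suc b) (full _) Rest (Rest-beyond (suc b)))
      (cong sum (map-cong (λ ρ → trans (afterTransfer-full a ρ (suc b) Rest)
                                       (numPerfectMatchings-staircase m (suc a) (suc b) (Defs.R ρ))) (E (τ ∷ []))))

  staircase-unique : ∀ k a b ε → Unique (staircase k a b ε)
  staircase-unique zero    a b [] = []
  staircase-unique (suc k) a b ε  = Unique.++⁺ (column-unique a b ε) (staircase-unique k (suc a) (suc b) _) disjoint
    where
    disjoint : ∀ {u} → u ∈ column a b ε × u ∈ staircase k (suc a) (suc b) _ → ⊥
    disjoint (u∈column , u∈rest) with All.lookup (column-⊆ a b ε) u∈column | All.lookup (staircase-⊆ k (suc a) (suc b) _) u∈rest
    ... | inColumn _ _ refl | _ , _ , 1+a≤c , eq = ℕ.<-irrefl (proj₁ (square-injective eq)) 1+a≤c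

  column-full-∈ : ∀ L a b d → b ≤ d → d < L + b → square a d ∈ column a b (full L)
  column-full-∈ zero    a b d b≤d d<b     = ⊥-elim (ℕ.<-irrefl refl (≤-trans d<b b≤d))
  column-full-∈ (suc L) a b d b≤d d<1+L+b with ℕ.m≤n⇒m<n∨m≡n b≤d
  ... | inj₂ refl = here refl
  ... | inj₁ b<d  = there (column-full-∈ L a (suc b) d b<d (subst (d <_) (sym (+-suc L b)) d<1+L+b))

  InStaircase : ℕ → ℕ → ℕ → ℕ → Set
  InStaircase k a c d = a ≤ c × c ≤ d × d + c < double a + double k

  private
    double-shift : ∀ a k → double (suc a) + double k ≡ double a + double (suc k)
    double-shift a k = sym (trans (+-suc (double a) _) (cong suc (+-suc (double a) (double k))))

    double+≡ : ∀ a L → double a + L ≡ (L + a) + a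
    double+≡ a L = trans (cong (_+ L) (double≡+ a)) (trans (+-comm (a + a) L) (sym (ℕ.+-assoc L a a)))

  staircase-∈⁻ : ∀ k a {u} → u ∈ staircase k a a (full (double k)) → ∃₂ λ c d → u ≡ square c d × InStaircase k a c d
  staircase-∈⁻ (suc k) a u∈ with ∈-++⁻ (column a a (full (double (suc k)))) u∈
  ... | inj₁ u∈column with All.lookup (column-⊆ a a (full (double (suc k)))) u∈column
  ...   | inColumn {d} a≤d d<L+a eq =
    a , d , eq , ℕ.≤-refl , a≤d , subst (d + a <_) (sym (double+≡ a (double (suc k)))) (ℕ.+-monoˡ-≤ a d<L+a)
  staircase-∈⁻ (suc k) a u∈ | inj₂ u∈rest with staircase-∈⁻ k (suc a) u∈rest
  ...   | c , d , eq , 1+a≤c , c≤d , bound = c , d , eq , ℕ.<⇒≤ 1+a≤c , c≤d , subst (d + c <_) (double-shift a k) bound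

  staircase-∈⁺ : ∀ k a c d → InStaircase k a c d → square c d ∈ staircase k a a (full (double k))
  staircase-∈⁺ zero    a c d (a≤c , c≤d , bound) =
    ⊥-elim (ℕ.<-irrefl refl (≤-trans bound
      (subst (_≤ d + c) (sym (trans (+-identityʳ _) (double≡+ a))) (ℕ.+-mono-≤ (≤-trans a≤c c≤d) a≤c))))
  staircase-∈⁺ (suc k) a c d (a≤c , c≤d , bound) with ℕ.m≤n⇒m<n∨m≡n a≤c
  ... | inj₂ refl = ∈-++⁺ˡ (column-full-∈ (double (suc k)) a a d c≤d
                            (ℕ.+-cancelʳ-≤ a (suc d) _ (subst (suc (d + a) ≤_) (double+≡ a _) bound)))
  ... | inj₁ a<c  = ∈-++⁺ʳ _ (staircase-∈⁺ k (suc a) c d (a<c , c≤d , subst (d + c <_) (sym (double-shift a k)) bound))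

-- The half diamond H_n

module HalfDiamond (n : ℕ) where

  open Grid (+ 0) (+ n)

  -- InH n (square a d), read off in terms of the column a and the row d.
  InHalfDiamond : ℕ → ℕ → Set
  InHalfDiamond a d = 1 ≤ a × a ≤ d × d + a ≤ suc (double n)

  private
    [0-a]+1≤0⇒1≤a : ∀ a → (+ 0 ℤ.- + a) ℤ.+ ℤ.1ℤ ℤ.≤ ℤ.0ℤ → 1 ≤ a
    [0-a]+1≤0⇒1≤a zero    (ℤ.+≤+ ())
    [0-a]+1≤0⇒1≤a (suc a) _ = s≤s z≤n

    1≤a⇒[0-a]+1≤0 : ∀ a → 1 ≤ a → (+ 0 ℤ.- + a) ℤ.+ ℤ.1ℤ ℤ.≤ ℤ.0ℤ
    1≤a⇒[0-a]+1≤0 (suc a) _ = ℤ.≤-trans (ℤ.≤-reflexive (ℤ.[1+m]⊖[1+n]≡m⊖n 0 a)) (ℤ.0⊖m≤+ a)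

    corner⇒ : ∀ i j {p q} → ℤ.∣ i ∣ ≡ p → ℤ.∣ j ∣ ≡ q → inDiamond n i j → p + q ≤ suc n
    corner⇒ i j ∣i∣≡p ∣j∣≡q = subst₂ (λ p q → p + q ≤ suc n) ∣i∣≡p ∣j∣≡q

    corner⇐ : ∀ i j {p q} → ℤ.∣ i ∣ ≡ p → ℤ.∣ j ∣ ≡ q → p + q ≤ suc n → inDiamond n i j
    corner⇐ i j ∣i∣≡p ∣j∣≡q = subst₂ (λ p q → p + q ≤ suc n) (sym ∣i∣≡p) (sym ∣j∣≡q)

    ∣1-a∣≤a : ∀ {a} → 1 ≤ a → ∣ 1 - a ∣ ≤ a
    ∣1-a∣≤a {suc a} _ = ℕ.n≤1+n a

    n+1+n≡1+double : n + suc n ≡ suc (double n)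
    n+1+n≡1+double = trans (+-suc n n) (cong suc (sym (double≡+ n)))

  InH⇒InHalfDiamond : ∀ a d → InH n (square a d) → InHalfDiamond a d
  InH⇒InHalfDiamond a d (c₁ , _ , c₃ , _ , left) = [0-a]+1≤0⇒1≤a a left , a≤d , d+a≤
    where
    open ≤-Reasoning
    x = + 0 ℤ.- + a
    y = + n ℤ.- + d
    top : a + ∣ n - d ∣ ≤ suc n
    top = corner⇒ x y (∣[m-k]∣ 0 a) (∣[m-k]∣ n d) c₁
    bottom : a + ∣ suc n - d ∣ ≤ suc n
    bottom = corner⇒ x (y ℤ.+ ℤ.1ℤ) (∣[m-k]∣ 0 a) (∣[m-k]+1∣ n d) c₃
    a≤d : a ≤ d
    a≤d = ℕ.+-cancelʳ-≤ ∣ suc n - d ∣ a d (begin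
      a + ∣ suc n - d ∣ ≤⟨ bottom ⟩
      suc n             ≤⟨ m≤n+∣n-m∣ (suc n) d ⟩
      d + ∣ d - suc n ∣ ≡⟨ cong (λ k → d + k) (∣-∣-comm d (suc n)) ⟩
      d + ∣ suc n - d ∣ ∎)
    d+a≤ : d + a ≤ suc (double n)
    d+a≤ = begin
      d + a                 ≤⟨ ℕ.+-monoˡ-≤ a (m≤n+∣n-m∣ d n) ⟩
      (n + ∣ n - d ∣) + a   ≡⟨ ℕ.+-assoc n _ a ⟩
      n + (∣ n - d ∣ + a)   ≡⟨ cong (λ k → n + k) (+-comm ∣ n - d ∣ a) ⟩
      n + (a + ∣ n - d ∣)   ≤⟨ ℕ.+-monoʳ-≤ n top ⟩
      n + suc n             ≡⟨ n+1+n≡1+double ⟩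
      suc (double n)        ∎

  InHalfDiamond⇒InH : ∀ a d → InHalfDiamond a d → InH n (square a d)
  InHalfDiamond⇒InH a d (1≤a , a≤d , d+a≤) =
    corner⇐ x y (∣[m-k]∣ 0 a) (∣[m-k]∣ n d) top ,
    corner⇐ (x ℤ.+ ℤ.1ℤ) y (∣[m-k]+1∣ 0 a) (∣[m-k]∣ n d) (≤-trans (ℕ.+-monoˡ-≤ _ (∣1-a∣≤a 1≤a)) top) ,
    corner⇐ x (y ℤ.+ ℤ.1ℤ) (∣[m-k]∣ 0 a) (∣[m-k]+1∣ n d) bottom ,
    corner⇐ (x ℤ.+ ℤ.1ℤ) (y ℤ.+ ℤ.1ℤ) (∣[m-k]+1∣ 0 a) (∣[m-k]+1∣ n d)
            (≤-trans (ℕ.+-monoˡ-≤ _ (∣1-a∣≤a 1≤a)) bottom) ,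
    1≤a⇒[0-a]+1≤0 a 1≤a
    where
    x = + 0 ℤ.- + a
    y = + n ℤ.- + d
    d+a≤n+1+n : d + a ≤ n + suc n
    d+a≤n+1+n = subst (d + a ≤_) (sym n+1+n≡1+double) d+a≤
    top : a + ∣ n - d ∣ ≤ suc n
    top = subst (_≤ suc n) (+-comm ∣ n - d ∣ a) (∣m-n∣+k≤w n d a (suc n)
      (subst (n + a ≤_) (+-comm (suc n) d) (ℕ.+-mono-≤ (ℕ.n≤1+n n) a≤d)) d+a≤n+1+n)
    bottom : a + ∣ suc n - d ∣ ≤ suc n
    bottom = subst (_≤ suc n) (+-comm ∣ suc n - d ∣ a) (∣m-n∣+k≤w (suc n) d a (suc n)
      (subst (suc n + a ≤_) (+-comm (suc n) d) (ℕ.+-monoʳ-≤ (suc n) a≤d)) (≤-trans d+a≤n+1+n (ℕ.n≤1+n _)))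

  InH⇒square : ∀ {u} → InH n u → ∃₂ λ a d → u ≡ square a d
  InH⇒square {+ zero   , j}         (_ , _ , _ , _ , ℤ.+≤+ ())
  InH⇒square {+ suc _  , j}         (_ , _ , _ , _ , ℤ.+≤+ ())
  InH⇒square { -[1+ k ] , -[1+ m ]} _ = suc k , n + suc m , cong (-[1+ k ] ,_) (sym (begin
    + n ℤ.- + (n + suc m)  ≡⟨ ℤ.[+m]-[+n]≡m⊖n n (n + suc m) ⟩
    n ⊖ (n + suc m)        ≡⟨ cong (_⊖ (n + suc m)) (sym (+-identityʳ n)) ⟩
    (n + 0) ⊖ (n + suc m)  ≡⟨ ℤ.+-cancelˡ-⊖ n 0 (suc m) ⟩
    -[1+ m ]               ∎))
    where open ≡-Reasoning
  InH⇒square { -[1+ k ] , + m}      (_ , _ , c₃ , _ , _) = suc k , n ∸ m , cong (-[1+ k ] ,_) (sym (begin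
    + n ℤ.- + (n ∸ m)  ≡⟨ ℤ.[+m]-[+n]≡m⊖n n (n ∸ m) ⟩
    n ⊖ (n ∸ m)        ≡⟨ ℤ.⊖-≥ (ℕ.m∸n≤m n m) ⟩
    + (n ∸ (n ∸ m))    ≡⟨ cong +_ (ℕ.m∸[m∸n]≡n m≤n) ⟩
    + m                ∎))
    where
    open ≡-Reasoning
    m≤n : m ≤ n
    m≤n = ℕ.≤-pred (≤-trans (ℕ.m≤n+m (suc m) (suc k)) (subst (_≤ suc n) (cong (λ t → suc k + t) (ℕ.+-comm m 1)) c₃))

  private
    lo : ℤ
    lo = ℤ.- (+ suc n)
    width : ℕ
    width = suc (suc (2 ℕ.* suc n))
    coordinates : List ℤ
    coordinates = rangeℤ lo width

    candidates≡ : candidates n ≡ cartesianProduct coordinates coordinates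
    candidates≡ = concatMap≡cartesianProduct coordinates coordinates

  candidates-unique : Unique (candidates n)
  candidates-unique = subst Unique (sym candidates≡) (Unique.cartesianProduct⁺ (rangeℤ-unique lo width) (rangeℤ-unique lo width))

  private
    -N+k≡m-d : ∀ N m k d → k + d ≡ N + m → ℤ.- (+ N) ℤ.+ + k ≡ + m ℤ.- + d
    -N+k≡m-d N m k d k+d≡N+m = begin
      ℤ.- (+ N) ℤ.+ + k                          ≡⟨ cong (λ z → ℤ.- (+ N) ℤ.+ z) (add-sub (+ k) (+ d)) ⟩
      ℤ.- (+ N) ℤ.+ ((+ k ℤ.+ + d) ℤ.- + d)      ≡⟨ cong (λ z → ℤ.- (+ N) ℤ.+ (+ z ℤ.- + d)) k+d≡N+m ⟩
      ℤ.- (+ N) ℤ.+ ((+ N ℤ.+ + m) ℤ.- + d)      ≡⟨ cancel (+ N) (+ m) (+ d) ⟩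
      + m ℤ.- + d                                ∎
      where
      open ≡-Reasoning
      add-sub : ∀ (p q : ℤ) → p ≡ (p ℤ.+ q) ℤ.- q
      add-sub = solve-∀
      cancel : ∀ (p q r : ℤ) → ℤ.- p ℤ.+ ((p ℤ.+ q) ℤ.- r) ≡ q ℤ.- r
      cancel = solve-∀

    m+m≤1+n+n⇒m≤n : ∀ m k → m + m ≤ suc (k + k) → m ≤ k
    m+m≤1+n+n⇒m≤n zero    k       _ = z≤n
    m+m≤1+n+n⇒m≤n (suc m) zero    (s≤s m+1+m≤0) = ⊥-elim (ℕ.1+n≰n (≤-trans (s≤s z≤n) (subst (_≤ 0) (+-suc m m) m+1+m≤0)))
    m+m≤1+n+n⇒m≤n (suc m) (suc k) (s≤s le) =
      s≤s (m+m≤1+n+n⇒m≤n m k (ℕ.≤-pred (subst₂ _≤_ (+-suc m m) (cong suc (+-suc k k)) le)))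

  InHalfDiamond⇒∈candidates : ∀ {a d} → InHalfDiamond a d → square a d ∈ candidates n
  InHalfDiamond⇒∈candidates {a} {d} (1≤a , a≤d , d+a≤) = subst (square a d ∈_) (sym candidates≡)
    (∈-cartesianProduct⁺
      (∈coordinates 0 (suc n ∸ a) a (trans (ℕ.m∸n+n≡m a≤1+n) (sym (+-identityʳ _)))
                    (≤-trans (ℕ.m∸n≤m (suc n) a) (ℕ.m≤m+n (suc n) n)))
      (∈coordinates n (suc n + n ∸ d) d (ℕ.m∸n+n≡m d≤1+n+n) (ℕ.m∸n≤m (suc n + n) d)))
    where
    d+a≤1+n+n : d + a ≤ suc n + n
    d+a≤1+n+n = subst (d + a ≤_) (cong suc (double≡+ n)) d+a≤
    a≤1+n : a ≤ suc n
    a≤1+n = ℕ.m≤n⇒m≤1+n (m+m≤1+n+n⇒m≤n a n (≤-trans (ℕ.+-monoˡ-≤ a a≤d) d+a≤1+n+n))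
    d≤1+n+n : d ≤ suc n + n
    d≤1+n+n = ≤-trans (ℕ.m≤m+n d a) d+a≤1+n+n
    1+n+n≤ : suc n + n ≤ suc (2 ℕ.* suc n)
    1+n+n≤ = ℕ.m≤n⇒m≤1+n (ℕ.+-monoʳ-≤ (suc n) (ℕ.≤-trans (ℕ.n≤1+n n) (ℕ.m≤m+n (suc n) 0)))
    ∈coordinates : ∀ m k d → k + d ≡ suc n + m → k ≤ suc n + n → + m ℤ.- + d ∈ coordinates
    ∈coordinates m k d k+d≡ k≤ = subst (_∈ coordinates) (-N+k≡m-d (suc n) m k d k+d≡) (∈-rangeℤ lo (s≤s (≤-trans k≤ 1+n+n≤)))

  ∈verticesH⇒∈staircase : ∀ {u} → u ∈ verticesH n → u ∈ staircase n 1 1 (full (double n))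
  ∈verticesH⇒∈staircase {u} u∈ with ∈-filter⁻ (inH? n) {xs = candidates n} u∈
  ... | _ , inH with InH⇒square {u} inH
  ...   | a , d , refl with InH⇒InHalfDiamond a d inH
  ...     | 1≤a , a≤d , d+a≤ = staircase-∈⁺ n 1 a d (1≤a , a≤d , s≤s d+a≤)

  ∈staircase⇒∈verticesH : ∀ {u} → u ∈ staircase n 1 1 (full (double n)) → u ∈ verticesH n
  ∈staircase⇒∈verticesH u∈ with staircase-∈⁻ n 1 u∈
  ... | a , d , refl , 1≤a , a≤d , bound =
    ∈-filter⁺ (inH? n) (InHalfDiamond⇒∈candidates inHalf) (InHalfDiamond⇒InH a d inHalf)
    where
    inHalf : InHalfDiamond a d
    inHalf = 1≤a , a≤d , ℕ.≤-pred bound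

  verticesH↭staircase : verticesH n ↭ staircase n 1 1 (full (double n))
  verticesH↭staircase = ∼bag⇒↭ (unique∧set⇒bag (Unique.filter⁺ (inH? n) candidates-unique) (staircase-unique n 1 1 _)
                                                (mk⇔ ∈verticesH⇒∈staircase ∈staircase⇒∈verticesH))

  private
    nextRow : ∀ b → (+ n ℤ.- + b) ℤ.- ℤ.1ℤ ≡ + n ℤ.- + suc b
    nextRow b = trans (sub-sub (+ n) (+ b) (+ 1)) (cong (λ q → + n ℤ.- + q) (+-comm b 1))
      where
      sub-sub : ∀ (p q r : ℤ) → (p ℤ.- q) ℤ.- r ≡ p ℤ.- (q ℤ.+ r)
      sub-sub = solve-∀

  deletedFrom≡column : ∀ {L} b (v : Vec Bool L) → deletedFrom (+ n ℤ.- + b) v ≡ column 1 b (Defs.R v)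
  deletedFrom≡column b []          = refl
  deletedFrom≡column b (true ∷ v)  = cong (square 1 b ∷_) (trans (cong (λ j → deletedFrom j v) (nextRow b)) (deletedFrom≡column (suc b) v))
  deletedFrom≡column b (false ∷ v) = trans (cong (λ j → deletedFrom j v) (nextRow b)) (deletedFrom≡column (suc b) v)

  private
    notIn? : (D : List Sq) → Decidable {A = Sq} (λ u → ¬ u ∈ D)
    notIn? D u = ¬? (u ∈? D)

  filter-∉-column : ∀ {L} a b (v : Vec Bool L) D →
    (∀ d → b ≤ d → square a d ∈ D → square a d ∈ column a b (Defs.R v)) →
    (∀ d → b ≤ d → square a d ∈ column a b (Defs.R v) → square a d ∈ D) →
    filter (notIn? D) (column a b (full L)) ≡ column a b v
  filter-∉-column a b []          D D⊆ ⊆D = refl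
  filter-∉-column {suc L} a b (true ∷ v)  D D⊆ ⊆D = trans
    (filter-reject (notIn? D) {square a b} {column a (suc b) (full L)} (λ ∉D → ∉D (⊆D b ℕ.≤-refl (here refl))))
    (filter-∉-column a (suc b) v D (λ d b<d ∈D → there⁻ b<d (D⊆ d (ℕ.<⇒≤ b<d) ∈D))
                                   (λ d b<d ∈col → ⊆D d (ℕ.<⇒≤ b<d) (there ∈col)))
    where
    there⁻ : ∀ {d} → b < d → square a d ∈ square a b ∷ column a (suc b) (Defs.R v) → square a d ∈ column a (suc b) (Defs.R v)
    there⁻ {d} b<d (here eq) = ⊥-elim (ℕ.<-irrefl (sym (proj₂ (square-injective {a} {d} {a} {b} eq))) b<d)
    there⁻ b<d (there ∈col) = ∈col
  filter-∉-column {suc L} a b (false ∷ v) D D⊆ ⊆D = trans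
    (filter-accept (notIn? D) {square a b} {column a (suc b) (full L)}
      (λ ∈D → column-∌ {a = a} {b = b} a (suc b) (Defs.R v) (λ b<d (_ , b≡d) → ℕ.<-irrefl b≡d b<d) (D⊆ b ℕ.≤-refl ∈D)))
    (cong (square a b ∷_) (filter-∉-column a (suc b) v D (λ d → D⊆ d ∘ ℕ.<⇒≤) (λ d → ⊆D d ∘ ℕ.<⇒≤)))

  filter-∉-staircase : ∀ k a b ε → filter (notIn? (column a b (Defs.R ε))) (staircase k a b (full (double k))) ≡ staircase k a b ε
  filter-∉-staircase zero    a b [] = refl
  filter-∉-staircase (suc k) a b ε  = begin
    filter (notIn? D) (column a b (full (double (suc k))) ++ rest)
      ≡⟨ filter-++ (notIn? D) (column a b (full (double (suc k)))) rest ⟩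
    filter (notIn? D) (column a b (full (double (suc k)))) ++ filter (notIn? D) rest
      ≡⟨ cong₂ _++_ (filter-∉-column a b ε D (λ _ _ ∈D → ∈D) (λ _ _ ∈D → ∈D)) (filter-all (notIn? D) rest∌) ⟩
    column a b ε ++ rest ∎
    where
    open ≡-Reasoning
    D = column a b (Defs.R ε)
    rest = staircase k (suc a) (suc b) (full (double k))
    rest∌ : All (λ u → ¬ u ∈ D) rest
    rest∌ = All.map (λ { (c , d , 1+a≤c , refl) →
                          column-∌ {a = c} {b = d} a b (Defs.R ε) (λ _ (c≡a , _) → ℕ.<-irrefl (sym c≡a) 1+a≤c) })
                    (staircase-⊆ k (suc a) (suc b) _)

  vertices↭staircase : ∀ ε → vertices n ε ↭ staircase n 1 1 ε
  vertices↭staircase ε = begin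
    filter (notIn? (deleted n ε)) (verticesH n)
      ↭⟨ filter-↭ (notIn? (deleted n ε)) verticesH↭staircase ⟩
    filter (notIn? (deleted n ε)) (staircase n 1 1 (full (double n)))
      ≡⟨ cong (λ D → filter (notIn? D) (staircase n 1 1 (full (double n)))) (deletedFrom≡column 1 ε) ⟩
    filter (notIn? (column 1 1 (Defs.R ε))) (staircase n 1 1 (full (double n)))
      ≡⟨ filter-∉-staircase n 1 1 ε ⟩
    staircase n 1 1 ε ∎
    where open PermutationReasoning

lemma5 : (n : ℕ) → 1 ≤ n → (ε : Vec Bool (double n)) →
    C n ε ≡ numPerfectMatchings (vertices n ε)
lemma5 (suc m) _ ε = begin
  C (suc m) ε                                   ≡⟨ numPerfectMatchings-staircase m 1 1 ε ⟨
  numPerfectMatchings (staircase (suc m) 1 1 ε) ≡⟨ numPerfectMatchings-↭ (vertices↭staircase ε) ⟨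
  numPerfectMatchings (vertices (suc m) ε)      ∎
  where
  open ≡-Reasoning
  open Grid (+ 0) (+ suc m)
  open HalfDiamond (suc m)
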